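{- For all integers $n\ge2$, $$\mathsf{AExc}_n^{+}(s,t)=s\,\mathsf{AExc}_{n-1}^{+}(s,t)+t\,\mathsf{AExc}_{n-1}^{ - }(s,t)+\tfrac12\,st\,DA_{n-1}(s,t),$$ $$\mathsf{AExc}_n^{ - }(s,t)=s\,\mathsf{AExc}_{n-1}^{ - }(s,t)+t\,\mathsf{AExc}_{n-1}^{+}(s,t)+\tfrac12\,st\,DA_{n-1}(s,t).$$
   Context: $\mathfrak{S}_n$ is the symmetric group on $[n]$, $\mathcal{A}_n$ its even permutations. $\mathsf{exc}(\pi)=|\{i:\pi_i>i\}|$, $\mathsf{nexc}(\pi)=|\{i:\pi_i\le i\}|$, $\mathsf{des}(\pi)=|\{i\in[n-1]:\pi_i>\pi_{i+1}\}|$, $\mathsf{asc}(\pi)=|\{i\in[n-1]:\pi_i<\pi_{i+1}\}|$. $\mathsf{AExc}_n^{+}(s,t)=\sum_{\pi\in\mathcal{A}_n}t^{\mathsf{exc}(\pi)}s^{\mathsf{nexc}(\pi)-1}$, $\mathsf{AExc}_n^{ - }(s,t)=\sum_{\pi\in\mathfrak{S}_n\setminus\mathcal{A}_n}t^{\mathsf{exc}(\pi)}s^{\mathsf{nexc}(\pi)-1}$, $A_m(s,t)=\sum_{\pi\in\mathfrak{S}_m}t^{\mathsf{des}(\pi)}s^{\mathsf{asc}(\pi)}$, and $D=\frac{\partial}{\partial s}+\frac{\partial}{\partial t}$. -}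

module Defs where

open import Data.Bool using (Bool; true; false; _∧_; not; if_then_else_)
open import Data.Nat using (ℕ; zero; suc; _∸_; _<ᵇ_; _≡ᵇ_)
import Data.Nat as N
open import Data.Fin using (Fin; toℕ)
open import Data.List using (List; []; _∷_; map; concatMap; filter; length; allFin)
open import Data.Vec using (Vec; lookup; toList)
import Data.Vec as V
open import Data.Integer using (+_)
open import Data.Rational using (ℚ; _/_; ½; 0ℚ; _+_; _*_)

-- Permutations of [n], represented 0-based as vectors (π(0),…,π(n-1))
-- of elements of Fin n with pairwise distinct entries.

allVecs : (k n : ℕ) → List (Vec (Fin n) k)
allVecs zero    n = V.[] ∷ []
allVecs (suc k) n = concatMap (λ x → map (x V.∷_) (allVecs k n)) (allFin n)

countB : {A : Set} → (A → Bool) → List A → ℕ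
countB p []       = 0
countB p (x ∷ xs) = if p x then suc (countB p xs) else countB p xs

allB : {A : Set} → (A → Bool) → List A → Bool
allB p []       = true
allB p (x ∷ xs) = p x ∧ allB p xs

distinct : List ℕ → Bool
distinct []       = true
distinct (x ∷ xs) = allB (λ y → not (x ≡ᵇ y)) xs ∧ distinct xs

vals : {n : ℕ} → Vec (Fin n) n → List ℕ
vals π = map toℕ (toList π)

perms : (n : ℕ) → List (Vec (Fin n) n)
perms n = filter (λ π → Data.Bool._≟_ (distinct (vals π)) true) (allVecs n n)
  where import Data.Bool

invL : List ℕ → ℕ
invL []       = 0
invL (x ∷ xs) = countB (λ y → y <ᵇ x) xs N.+ invL xs

isEven : ℕ → Bool
isEven zero          = true
isEven (suc zero)    = false
isEven (suc (suc k)) = isEven k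

evenPerm : {n : ℕ} → Vec (Fin n) n → Bool
evenPerm π = isEven (invL (vals π))

-- exc π = #{i : π_i > i},  nexc π = #{i : π_i ≤ i}   (shift to 0-based is harmless)
exc : {n : ℕ} → Vec (Fin n) n → ℕ
exc {n} π = countB (λ i → toℕ i <ᵇ toℕ (lookup π i)) (allFin n)

nexc : {n : ℕ} → Vec (Fin n) n → ℕ
nexc {n} π = countB (λ i → not (toℕ i <ᵇ toℕ (lookup π i))) (allFin n)

desL : List ℕ → ℕ
desL []           = 0
desL (x ∷ [])     = 0
desL (x ∷ y ∷ xs) = (if y <ᵇ x then 1 else 0) N.+ desL (y ∷ xs)

ascL : List ℕ → ℕ
ascL []           = 0
ascL (x ∷ [])     = 0
ascL (x ∷ y ∷ xs) = (if x <ᵇ y then 1 else 0) N.+ ascL (y ∷ xs)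

des asc : {n : ℕ} → Vec (Fin n) n → ℕ
des π = desL (vals π)
asc π = ascL (vals π)

-- Polynomials in s,t with rational coefficients, given by their
-- coefficient function: P a b = coefficient of s^a t^b.

Poly : Set
Poly = ℕ → ℕ → ℚ

fromℕ : ℕ → ℚ
fromℕ k = + k / 1

_⊕_ : Poly → Poly → Poly
(P ⊕ Q) a b = P a b + Q a b
infixl 6 _⊕_

sMul : Poly → Poly
sMul P zero    b = 0ℚ
sMul P (suc a) b = P a b

tMul : Poly → Poly
tMul P a zero    = 0ℚ
tMul P a (suc b) = P a b

_·_ : ℚ → Poly → Poly
(c · P) a b = c * P a b
infixr 7 _·_

∂s ∂t D : Poly → Poly
∂s P a b = fromℕ (suc a) * P (suc a) b
∂t P a b = fromℕ (suc b) * P a (suc b)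
D P = ∂s P ⊕ ∂t P

genPoly : {A : Set} → (A → ℕ) → (A → ℕ) → List A → Poly
genPoly sexp texp xs a b =
  fromℕ (countB (λ x → (sexp x ≡ᵇ a) ∧ (texp x ≡ᵇ b)) xs)

AExc⁺ : ℕ → Poly
AExc⁺ n = genPoly (λ π → nexc π ∸ 1) exc (filter (λ π → Data.Bool._≟_ (evenPerm π) true) (perms n))
  where import Data.Bool

AExc⁻ : ℕ → Poly
AExc⁻ n = genPoly (λ π → nexc π ∸ 1) exc (filter (λ π → Data.Bool._≟_ (evenPerm π) false) (perms n))
  where import Data.Bool

-- A_m(s,t) = Σ_{π ∈ S_m} t^des(π) s^asc(π)
Eul : ℕ → Poly
Eul m = genPoly asc des (perms m)

module Submission where

-- Permutations of {0,…,m-1} are handled as one-line words (lists of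
-- naturals) and polynomials in s, t as coefficient functions F a b ∈ ℕ
-- (the coefficient of s^a t^b); the rational polynomials of Defs only
-- enter in the last step.
--
-- Sums over lists and ranges; a sum is invariant under
--    rearrangements preserving multiplicities, so every bijection
--    Sₘ × {0,…,m} ≅ Sₘ₊₁ (a Decomposition) turns a sum over Sₘ₊₁ into a
--    double sum (sum-decompose).
-- 2. Two such bijections: transpose, where m takes the place of the i-th
--    entry and that entry moves to the end (multiplication by the
--    transposition (i m)), and insertion of m at position j.
-- 3. Tracking exc, nexc and the sign through transpose, and asc, des
--    through insertion, gives with R(P,M) = sP + st∂ₜM + t∂ₛ(sM)
--        AExc^±ₘ₊₁ = R(AExc^±ₘ, AExc^∓ₘ)    and    Aₘ₊₁ = R(Aₘ, Aₘ)    (m ≥ 1).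
-- 4. By induction Aₘ = AExc⁺ₘ + AExc⁻ₘ and D AExc⁺ₘ = D AExc⁻ₘ, and under
--    these invariants R(P,M) = sP + tM + ½ st D(P+M), which is lemma12.

open import Defs
open import Data.Bool using (Bool; true; false; _∧_; not; if_then_else_)
import Data.Bool as Bool
import Data.Bool.Properties as BoolP
open import Data.Nat using (ℕ; zero; suc; _+_; _*_; _∸_; _<ᵇ_; _≡ᵇ_; _≤_; _<_; z≤n; s≤s)
import Data.Nat.Properties as ℕP
open import Data.Nat.Tactic.RingSolver using (solve-∀)
open import Algebra.Properties.CommutativeSemigroup ℕP.+-commutativeSemigroup
  using () renaming (interchange to +-interchange; x∙yz≈y∙xz to +-left-comm)
open import Data.Fin using (Fin; toℕ) renaming (zero to fzero; suc to fsuc)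
open import Data.Vec using (Vec; lookup) renaming (_∷_ to _∷ᵥ_; [] to []ᵥ)
import Data.Vec as Vec
open import Data.List using (List; []; _∷_; [_]; map; concatMap; filter; length; _++_; tabulate; allFin; downFrom)
import Data.List.Properties as ListP
open import Data.List.Membership.Propositional using (_∈_)
open import Data.List.Relation.Unary.All using (All)
import Data.List.Relation.Unary.All as All
open import Data.List.Relation.Unary.Any using (here; there)
open import Data.Product using (Σ; _×_; _,_; proj₁; proj₂)
open import Data.Sum using (_⊎_; inj₁; inj₂)
open import Data.Empty using (⊥-elim)
open import Relation.Nullary using (does; yes; no)
open import Relation.Nullary.Decidable using (dec-true)
open import Relation.Binary.Definitions using (DecidableEquality)
open import Relation.Unary using (Decidable)
import Data.Integer as ℤ
import Data.Integer.Properties as ℤP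
open import Data.Nat.Coprimality using (1-coprimeTo)
import Data.Nat.Coprimality as Coprime
open import Data.Rational using (½; 0ℚ; mkℚ)
import Data.Rational as Q
import Data.Rational.Properties as QP
open import Relation.Binary.PropositionalEquality hiding ([_])
open ≡-Reasoning

ind : Bool → ℕ
ind true  = 1
ind false = 0

ind≤1 : ∀ x → ind x ≤ 1
ind≤1 true  = s≤s z≤n
ind≤1 false = z≤n

ind-∧ : ∀ x y → ind (x ∧ y) ≡ ind x * ind y
ind-∧ true  y = sym (ℕP.+-identityʳ (ind y))
ind-∧ false y = refl

≡ᵇ-sound : ∀ x y → (x ≡ᵇ y) ≡ true → x ≡ y
≡ᵇ-sound x y h = ℕP.≡ᵇ⇒≡ x y (subst Bool.T (sym h) _)

≡ᵇ-refl : ∀ x → (x ≡ᵇ x) ≡ true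
≡ᵇ-refl zero    = refl
≡ᵇ-refl (suc x) = ≡ᵇ-refl x

≡ᵇ-sym : ∀ x y → (x ≡ᵇ y) ≡ (y ≡ᵇ x)
≡ᵇ-sym zero    zero    = refl
≡ᵇ-sym zero    (suc y) = refl
≡ᵇ-sym (suc x) zero    = refl
≡ᵇ-sym (suc x) (suc y) = ≡ᵇ-sym x y

<ᵇ-complete : ∀ {x y} → x < y → (x <ᵇ y) ≡ true
<ᵇ-complete {zero}  {suc y} _         = refl
<ᵇ-complete {suc x} {suc y} (s≤s x<y) = <ᵇ-complete x<y

<ᵇ-sound : ∀ x y → (x <ᵇ y) ≡ true → x < y
<ᵇ-sound x y h = ℕP.<ᵇ⇒< x y (subst Bool.T (sym h) _)

<ᵇ-false : ∀ {x y} → y ≤ x → (x <ᵇ y) ≡ false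
<ᵇ-false {y = zero} _ = refl
<ᵇ-false {suc x} {suc y} (s≤s y≤x) = <ᵇ-false y≤x

<ᵇ-irrefl : ∀ x → (x <ᵇ x) ≡ false
<ᵇ-irrefl x = <ᵇ-false {x} ℕP.≤-refl

<ᵇ-trichotomy : ∀ x y → (x ≡ᵇ y) ≡ false → ind (x <ᵇ y) + ind (y <ᵇ x) ≡ 1
<ᵇ-trichotomy zero    (suc y) _ = refl
<ᵇ-trichotomy (suc x) zero    _ = refl
<ᵇ-trichotomy (suc x) (suc y) h = <ᵇ-trichotomy x y h

ind-<ᵇ-suc : ∀ v m → ind (v <ᵇ m) + ind (v ≡ᵇ m) ≡ ind (v <ᵇ suc m)
ind-<ᵇ-suc zero    zero    = refl
ind-<ᵇ-suc zero    (suc m) = refl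
ind-<ᵇ-suc (suc v) zero    = refl
ind-<ᵇ-suc (suc v) (suc m) = ind-<ᵇ-suc v m

∧-true : ∀ {x y} → (x ∧ y) ≡ true → x ≡ true × y ≡ true
∧-true {true} {true} _ = refl , refl

sumL : {A : Set} → (A → ℕ) → List A → ℕ
sumL f []       = 0
sumL f (x ∷ xs) = f x + sumL f xs

countB≡sumL : {A : Set} (p : A → Bool) (xs : List A) → countB p xs ≡ sumL (λ x → ind (p x)) xs
countB≡sumL p []       = refl
countB≡sumL p (x ∷ xs) with p x
... | true  = cong suc (countB≡sumL p xs)
... | false = countB≡sumL p xs

sumL-cong : {A : Set} {f g : A → ℕ} (xs : List A) → (∀ x → f x ≡ g x) → sumL f xs ≡ sumL g xs
sumL-cong []       h = refl
sumL-cong (x ∷ xs) h = cong₂ _+_ (h x) (sumL-cong xs h)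

sumL-congᴬ : {A : Set} {P : A → Set} {f g : A → ℕ} {xs : List A} →
  All P xs → (∀ x → P x → f x ≡ g x) → sumL f xs ≡ sumL g xs
sumL-congᴬ All.[]         h = refl
sumL-congᴬ (px All.∷ pxs) h = cong₂ _+_ (h _ px) (sumL-congᴬ pxs h)

sumL-zero : {A : Set} (xs : List A) → sumL (λ _ → 0) xs ≡ 0
sumL-zero []       = refl
sumL-zero (x ∷ xs) = sumL-zero xs

sumL-++ : {A : Set} (f : A → ℕ) (xs ys : List A) → sumL f (xs ++ ys) ≡ sumL f xs + sumL f ys
sumL-++ f []       ys = refl
sumL-++ f (x ∷ xs) ys = trans (cong (f x +_) (sumL-++ f xs ys)) (sym (ℕP.+-assoc (f x) _ _))

sumL-map : {A B : Set} (f : B → ℕ) (g : A → B) (xs : List A) → sumL f (map g xs) ≡ sumL (λ x → f (g x)) xs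
sumL-map f g []       = refl
sumL-map f g (x ∷ xs) = cong (f (g x) +_) (sumL-map f g xs)

sumL-concatMap : {A B : Set} (f : B → ℕ) (g : A → List B) (xs : List A) →
  sumL f (concatMap g xs) ≡ sumL (λ x → sumL f (g x)) xs
sumL-concatMap f g []       = refl
sumL-concatMap f g (x ∷ xs) =
  trans (sumL-++ f (g x) (concatMap g xs)) (cong (sumL f (g x) +_) (sumL-concatMap f g xs))

sumL-+ : {A : Set} (f g : A → ℕ) (xs : List A) → sumL (λ x → f x + g x) xs ≡ sumL f xs + sumL g xs
sumL-+ f g []       = refl
sumL-+ f g (x ∷ xs) rewrite sumL-+ f g xs = +-interchange (f x) (g x) (sumL f xs) (sumL g xs)

sumL-scale : {A : Set} (k : ℕ) (f : A → ℕ) (xs : List A) → sumL (λ x → k * f x) xs ≡ k * sumL f xs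
sumL-scale k f []       = sym (ℕP.*-zeroʳ k)
sumL-scale k f (x ∷ xs) rewrite sumL-scale k f xs = sym (ℕP.*-distribˡ-+ k (f x) _)

sumL-tabulate : {A : Set} {n : ℕ} (f : Fin n → A) (h : A → ℕ) →
  sumL h (tabulate f) ≡ sumL (λ i → h (f i)) (allFin n)
sumL-tabulate {n = zero}  f h = refl
sumL-tabulate {n = suc n} f h =
  cong (h (f fzero) +_) (trans (sumL-tabulate (λ i → f (fsuc i)) h) (sym (sumL-tabulate fsuc (λ i → h (f i)))))

sumBelow : ℕ → (ℕ → ℕ) → ℕ
sumBelow zero    f = 0
sumBelow (suc n) f = sumBelow n f + f n

sumBelow-cong : ∀ n {f g : ℕ → ℕ} → (∀ i → i < n → f i ≡ g i) → sumBelow n f ≡ sumBelow n g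
sumBelow-cong zero    h = refl
sumBelow-cong (suc n) h = cong₂ _+_ (sumBelow-cong n (λ i i<n → h i (ℕP.m≤n⇒m≤1+n i<n))) (h n ℕP.≤-refl)

sumBelow-+ : ∀ n (f g : ℕ → ℕ) → sumBelow n (λ i → f i + g i) ≡ sumBelow n f + sumBelow n g
sumBelow-+ zero    f g = refl
sumBelow-+ (suc n) f g rewrite sumBelow-+ n f g = +-interchange (sumBelow n f) (sumBelow n g) (f n) (g n)

sumBelow-scale : ∀ n k (f : ℕ → ℕ) → sumBelow n (λ i → k * f i) ≡ k * sumBelow n f
sumBelow-scale zero    k f = sym (ℕP.*-zeroʳ k)
sumBelow-scale (suc n) k f rewrite sumBelow-scale n k f = sym (ℕP.*-distribˡ-+ k (sumBelow n f) (f n))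

sumBelow-shift : ∀ n (f : ℕ → ℕ) → sumBelow (suc n) f ≡ f 0 + sumBelow n (λ i → f (suc i))
sumBelow-shift zero    f = ℕP.+-comm 0 (f 0)
sumBelow-shift (suc n) f rewrite sumBelow-shift n f = ℕP.+-assoc (f 0) _ _

sumBelow-zero : ∀ n → sumBelow n (λ _ → 0) ≡ 0
sumBelow-zero zero    = refl
sumBelow-zero (suc n) = trans (ℕP.+-identityʳ _) (sumBelow-zero n)

sumBelow-point : ∀ n c → sumBelow n (λ i → ind (c ≡ᵇ i)) ≡ ind (c <ᵇ n)
sumBelow-point zero    c       = refl
sumBelow-point (suc n) zero    = trans (sumBelow-shift n _) (cong (1 +_) (sumBelow-zero n))
sumBelow-point (suc n) (suc c) = trans (sumBelow-shift n _) (sumBelow-point n c)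

sumBelow-≤ : ∀ n (f : ℕ → ℕ) → (∀ v → v < n → f v ≤ 1) → sumBelow n f ≤ n
sumBelow-≤ zero    f h = z≤n
sumBelow-≤ (suc n) f h = ℕP.≤-trans
  (ℕP.+-mono-≤ (sumBelow-≤ n f (λ v v<n → h v (ℕP.m≤n⇒m≤1+n v<n))) (h n ℕP.≤-refl))
  (ℕP.≤-reflexive (ℕP.+-comm n 1))

pigeonhole : ∀ n (f : ℕ → ℕ) → (∀ v → v < n → f v ≤ 1) → sumBelow n f ≡ n → ∀ v → v < n → f v ≡ 1
pigeonhole (suc n) f h total v v<1+n = ℕP.≤-antisym (h v v<1+n) (case (ℕP.m≤n⇒m<n∨m≡n v<1+n))
  where
  h' : ∀ v → v < n → f v ≤ 1
  h' v v<n = h v (ℕP.m≤n⇒m≤1+n v<n)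
  prefix≤ : sumBelow n f ≤ n
  prefix≤ = sumBelow-≤ n f h'
  -- in total = prefix + f n both prefix ≤ n and f n ≤ 1 must be tight
  last≥1 : 1 ≤ f n
  last≥1 = ℕP.+-cancelˡ-≤ n 1 (f n)
    (ℕP.≤-trans (ℕP.≤-reflexive (trans (ℕP.+-comm n 1) (sym total))) (ℕP.+-monoˡ-≤ (f n) prefix≤))
  prefix≡ : sumBelow n f ≡ n
  prefix≡ = ℕP.≤-antisym prefix≤ (ℕP.+-cancelʳ-≤ 1 n (sumBelow n f)
    (ℕP.≤-trans (ℕP.≤-reflexive (trans (ℕP.+-comm n 1) (sym total))) (ℕP.+-monoʳ-≤ (sumBelow n f) (h n ℕP.≤-refl))))
  case : suc v < suc n ⊎ suc v ≡ suc n → 1 ≤ f v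
  case (inj₁ (s≤s v<n)) = ℕP.≤-reflexive (sym (pigeonhole n f h' prefix≡ v v<n))
  case (inj₂ refl)      = last≥1

sumL-middle : {A : Set} (f : A → ℕ) (ys₁ : List A) (x : A) (ys₂ : List A) →
  sumL f (ys₁ ++ x ∷ ys₂) ≡ f x + sumL f (ys₁ ++ ys₂)
sumL-middle f []        x ys₂ = refl
sumL-middle f (y ∷ ys₁) x ys₂ rewrite sumL-middle f ys₁ x ys₂ = +-left-comm (f y) (f x) _

module Multiplicity {A : Set} (_≟_ : DecidableEquality A) where

  mult : A → List A → ℕ
  mult z = sumL (λ y → ind (does (z ≟ y)))

  mult-head : ∀ x xs → mult x (x ∷ xs) ≡ suc (mult x xs)
  mult-head x xs rewrite dec-true (x ≟ x) refl = refl

  ∈⇒mult≢0 : ∀ {x xs} → x ∈ xs → mult x xs ≢ 0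
  ∈⇒mult≢0 {x} {.x ∷ xs} (here refl) e = ℕP.1+n≢0 (trans (sym (mult-head x xs)) e)
  ∈⇒mult≢0 {x} {y ∷ xs}  (there x∈)  e = ∈⇒mult≢0 x∈ (ℕP.m+n≡0⇒n≡0 (ind (does (x ≟ y))) e)

  mult≢0⇒split : ∀ x ys → mult x ys ≢ 0 → Σ (List A) λ ys₁ → Σ (List A) λ ys₂ → ys ≡ ys₁ ++ x ∷ ys₂
  mult≢0⇒split x []       h = ⊥-elim (h refl)
  mult≢0⇒split x (y ∷ ys) h with x ≟ y
  ... | yes refl = [] , ys , refl
  ... | no _ with mult≢0⇒split x ys h
  ... | ys₁ , ys₂ , e = y ∷ ys₁ , ys₂ , cong (y ∷_) e

  -- Induction on xs: remove the head from ys, where it must occur.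
  sumL-rearrange : (xs ys : List A) → (∀ z → mult z xs ≡ mult z ys) → (f : A → ℕ) → sumL f xs ≡ sumL f ys
  sumL-rearrange []       []       h f = refl
  sumL-rearrange []       (y ∷ ys) h f = ⊥-elim (ℕP.0≢1+n (trans (h y) (mult-head y ys)))
  sumL-rearrange (x ∷ xs) ys       h f
    with mult≢0⇒split x ys (λ e → ℕP.1+n≢0 (trans (sym (mult-head x xs)) (trans (h x) e)))
  ... | ys₁ , ys₂ , refl =
    trans (cong (f x +_) (sumL-rearrange xs (ys₁ ++ ys₂) h' f)) (sym (sumL-middle f ys₁ x ys₂))
    where
    h' : ∀ z → mult z xs ≡ mult z (ys₁ ++ ys₂)
    h' z = ℕP.+-cancelˡ-≡ (ind (does (z ≟ x))) _ _ (trans (h z) (sumL-middle _ ys₁ x ys₂))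

occ : ℕ → List ℕ → ℕ
occ v = sumL (λ y → ind (v ≡ᵇ y))

IsPerm : ℕ → List ℕ → Set
IsPerm n l = length l ≡ n × (∀ v → occ v l ≡ ind (v <ᵇ n))

isPermB : ℕ → List ℕ → Bool
isPermB n l = (length l ≡ᵇ n) ∧ (allB (λ y → y <ᵇ n) l ∧ distinct l)

occ-head0 : ∀ v x l → occ v (x ∷ l) ≡ 0 → (v ≡ᵇ x) ≡ false × occ v l ≡ 0
occ-head0 v x l h with v ≡ᵇ x
... | false = refl , h

allB-not⇒occ0 : ∀ x xs → allB (λ y → not (x ≡ᵇ y)) xs ≡ true → occ x xs ≡ 0
allB-not⇒occ0 x []       h = refl
allB-not⇒occ0 x (y ∷ xs) h with x ≡ᵇ y
... | false = allB-not⇒occ0 x xs h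

occ0⇒allB-not : ∀ x xs → occ x xs ≡ 0 → allB (λ y → not (x ≡ᵇ y)) xs ≡ true
occ0⇒allB-not x []       h = refl
occ0⇒allB-not x (y ∷ xs) h with occ-head0 x y xs h
... | x≢y , h' rewrite x≢y = occ0⇒allB-not x xs h'

distinct⇒occ≤1 : ∀ l → distinct l ≡ true → ∀ v → occ v l ≤ 1
distinct⇒occ≤1 []       h v = z≤n
distinct⇒occ≤1 (x ∷ xs) h v with ∧-true {allB (λ y → not (x ≡ᵇ y)) xs} h
... | fresh , rest with v ≡ᵇ x in v≟x
... | true  rewrite ≡ᵇ-sound v x v≟x | allB-not⇒occ0 x xs fresh = s≤s z≤n
... | false = distinct⇒occ≤1 xs rest v

occ≤1⇒distinct : ∀ l → (∀ v → occ v l ≤ 1) → distinct l ≡ true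
occ≤1⇒distinct []       h = refl
occ≤1⇒distinct (x ∷ xs) h = cong₂ _∧_ (occ0⇒allB-not x xs occ-x) (occ≤1⇒distinct xs h')
  where
  occ-x : occ x xs ≡ 0
  occ-x = ℕP.n≤0⇒n≡0 (ℕP.+-cancelˡ-≤ 1 _ _ (subst (λ t → ind t + occ x xs ≤ 1) (≡ᵇ-refl x) (h x)))
  h' : ∀ v → occ v xs ≤ 1
  h' v = ℕP.≤-trans (ℕP.m≤n+m (occ v xs) (ind (v ≡ᵇ x))) (h v)

allB<⇒occ0 : ∀ n l → allB (λ y → y <ᵇ n) l ≡ true → ∀ v → (v <ᵇ n) ≡ false → occ v l ≡ 0
allB<⇒occ0 n []       h v v≮n = refl
allB<⇒occ0 n (x ∷ xs) h v v≮n with ∧-true {x <ᵇ n} h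
... | x<n , rest with v ≡ᵇ x in v≟x
... | true  rewrite ≡ᵇ-sound v x v≟x with trans (sym x<n) v≮n
... | ()
allB<⇒occ0 n (x ∷ xs) h v v≮n | x<n , rest | false = allB<⇒occ0 n xs rest v v≮n

occ-pos⇒allB : ∀ (p : ℕ → Bool) l → (∀ v → 1 ≤ occ v l → p v ≡ true) → allB p l ≡ true
occ-pos⇒allB p []       h = refl
occ-pos⇒allB p (x ∷ xs) h = cong₂ _∧_ (h x x-occurs) (occ-pos⇒allB p xs h')
  where
  x-occurs : 1 ≤ occ x (x ∷ xs)
  x-occurs rewrite ≡ᵇ-refl x = s≤s z≤n
  h' : ∀ v → 1 ≤ occ v xs → p v ≡ true
  h' v le = h v (ℕP.≤-trans le (ℕP.m≤n+m (occ v xs) (ind (v ≡ᵇ x))))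

sumBelow-occ : ∀ n l → allB (λ y → y <ᵇ n) l ≡ true → sumBelow n (λ v → occ v l) ≡ length l
sumBelow-occ n []       h = sumBelow-zero n
sumBelow-occ n (x ∷ xs) h with ∧-true {x <ᵇ n} h
... | x<n , rest = begin
  sumBelow n (λ v → ind (v ≡ᵇ x) + occ v xs)              ≡⟨ sumBelow-+ n _ _ ⟩
  sumBelow n (λ v → ind (v ≡ᵇ x)) + sumBelow n (λ v → occ v xs)
    ≡⟨ cong₂ _+_ (trans point (cong ind x<n)) (sumBelow-occ n xs rest) ⟩
  suc (length xs)                                          ∎
  where
  point : sumBelow n (λ v → ind (v ≡ᵇ x)) ≡ ind (x <ᵇ n)
  point = trans (sumBelow-cong n (λ v _ → cong ind (≡ᵇ-sym v x))) (sumBelow-point n x)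

-- The boolean test is equivalent to being a permutation; the
-- non-trivial direction is the pigeonhole principle.
isPermB⇒IsPerm : ∀ n l → isPermB n l ≡ true → IsPerm n l
isPermB⇒IsPerm n l h with ∧-true {length l ≡ᵇ n} h
... | len , rest with ∧-true {allB (λ y → y <ᵇ n) l} rest
... | bounded , dist = ≡ᵇ-sound _ _ len , occurrences
  where
  occurrences : ∀ v → occ v l ≡ ind (v <ᵇ n)
  occurrences v with v <ᵇ n in v<n
  ... | false = allB<⇒occ0 n l bounded v v<n
  ... | true  = pigeonhole n (λ v → occ v l) (λ v _ → distinct⇒occ≤1 l dist v)
                  (trans (sumBelow-occ n l bounded) (≡ᵇ-sound _ _ len)) v (<ᵇ-sound v n v<n)

IsPerm-bounded : ∀ n l → IsPerm n l → allB (λ y → y <ᵇ n) l ≡ true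
IsPerm-bounded n l (_ , occurrences) = occ-pos⇒allB _ l pos
  where
  pos : ∀ v → 1 ≤ occ v l → (v <ᵇ n) ≡ true
  pos v le with v <ᵇ n | occurrences v
  ... | true  | _ = refl
  ... | false | e with subst (1 ≤_) e le
  ... | ()

IsPerm⇒isPermB : ∀ n l → IsPerm n l → isPermB n l ≡ true
IsPerm⇒isPermB n l p@(len , occurrences) =
  cong₂ _∧_ (subst (λ k → (length l ≡ᵇ k) ≡ true) len (≡ᵇ-refl (length l)))
            (cong₂ _∧_ (IsPerm-bounded n l p) (occ≤1⇒distinct l (λ v → subst (_≤ 1) (sym (occurrences v)) (ind≤1 _))))

_≟ʷ_ : DecidableEquality (List ℕ)
_≟ʷ_ = ListP.≡-dec ℕP._≟_

open Multiplicity _≟ʷ_ using (mult; ∈⇒mult≢0; sumL-rearrange)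

word : {n k : ℕ} → Vec (Fin n) k → List ℕ
word v = map toℕ (Vec.toList v)

permWords : ℕ → List (List ℕ)
permWords n = map vals (perms n)

sumL-filter : {A : Set} {P : A → Set} (P? : Decidable P) (f : A → ℕ) (xs : List A) →
  sumL f (filter P? xs) ≡ sumL (λ x → ind (does (P? x)) * f x) xs
sumL-filter P? f []       = refl
sumL-filter P? f (x ∷ xs) with does (P? x)
... | true  = cong₂ _+_ (sym (ℕP.+-identityʳ (f x))) (sumL-filter P? f xs)
... | false = sumL-filter P? f xs

allFin-point : ∀ n y → sumL (λ i → ind (y ≡ᵇ toℕ i)) (allFin n) ≡ ind (y <ᵇ n)
allFin-point zero    y       = refl
allFin-point (suc n) zero    =
  cong suc (trans (sumL-tabulate {n = n} fsuc (λ i → ind (0 ≡ᵇ toℕ i))) (sumL-zero (allFin n)))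
allFin-point (suc n) (suc y) = trans (sumL-tabulate {n = n} fsuc (λ i → ind (suc y ≡ᵇ toℕ i))) (allFin-point n y)

mult-allVecs : ∀ k n z →
  sumL (λ v → ind (does (z ≟ʷ word v))) (allVecs k n) ≡ ind ((length z ≡ᵇ k) ∧ allB (λ y → y <ᵇ n) z)
mult-allVecs zero    n []      = refl
mult-allVecs zero    n (y ∷ z) = refl
mult-allVecs (suc k) n []      =
  trans (sumL-concatMap _ (λ x → map (x ∷ᵥ_) (allVecs k n)) (allFin n))
        (trans (sumL-cong (allFin n) (λ x → trans (sumL-map _ _ (allVecs k n)) (sumL-zero (allVecs k n))))
               (sumL-zero (allFin n)))
mult-allVecs (suc k) n (y ∷ z) = begin
  sumL (λ v → ind (does ((y ∷ z) ≟ʷ word v))) (allVecs (suc k) n)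
    ≡⟨ sumL-concatMap _ (λ x → map (x ∷ᵥ_) (allVecs k n)) (allFin n) ⟩
  sumL (λ x → sumL (λ v → ind (does ((y ∷ z) ≟ʷ word v))) (map (x ∷ᵥ_) (allVecs k n))) (allFin n)
    ≡⟨ sumL-cong (allFin n) (λ x → trans (sumL-map _ _ (allVecs k n)) (headTail x)) ⟩
  sumL (λ x → ind (y ≡ᵇ toℕ x) * tails) (allFin n)
    ≡⟨ trans (sumL-cong (allFin n) (λ x → ℕP.*-comm (ind (y ≡ᵇ toℕ x)) tails)) (sumL-scale tails _ (allFin n)) ⟩
  tails * sumL (λ x → ind (y ≡ᵇ toℕ x)) (allFin n)
    ≡⟨ cong₂ _*_ (mult-allVecs k n z) (allFin-point n y) ⟩
  ind (lenOK ∧ restOK) * ind (y <ᵇ n)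
    ≡⟨ regroup lenOK (y <ᵇ n) restOK ⟩
  ind (lenOK ∧ ((y <ᵇ n) ∧ restOK)) ∎
  where
  tails = sumL (λ v → ind (does (z ≟ʷ word v))) (allVecs k n)
  lenOK = length z ≡ᵇ k
  restOK = allB (λ y → y <ᵇ n) z
  headTail : ∀ x → sumL (λ v → ind (does ((y ∷ z) ≟ʷ word (x ∷ᵥ v)))) (allVecs k n) ≡ ind (y ≡ᵇ toℕ x) * tails
  headTail x = trans (sumL-cong (allVecs k n) (λ v → ind-∧ (y ≡ᵇ toℕ x) _)) (sumL-scale (ind (y ≡ᵇ toℕ x)) _ (allVecs k n))
  regroup : ∀ a b c → ind (a ∧ c) * ind b ≡ ind (a ∧ (b ∧ c))
  regroup true  true  c = ℕP.*-identityʳ _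
  regroup true  false c = ℕP.*-zeroʳ (ind c)
  regroup false b     c = refl

mult-permWords : ∀ n z → mult z (permWords n) ≡ ind (isPermB n z)
mult-permWords n z = begin
  mult z (permWords n)
    ≡⟨ sumL-map _ vals (perms n) ⟩
  sumL (λ v → ind (does (z ≟ʷ vals v))) (perms n)
    ≡⟨ sumL-filter (λ π → distinct (vals π) Bool.≟ true) _ (allVecs n n) ⟩
  sumL (λ v → ind (does (distinct (vals v) Bool.≟ true)) * ind (does (z ≟ʷ vals v))) (allVecs n n)
    ≡⟨ sumL-cong (allVecs n n) (λ v → distinct-transfer (vals v)) ⟩
  sumL (λ v → ind (distinct z) * ind (does (z ≟ʷ vals v))) (allVecs n n)
    ≡⟨ sumL-scale (ind (distinct z)) _ (allVecs n n) ⟩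
  ind (distinct z) * sumL (λ v → ind (does (z ≟ʷ word v))) (allVecs n n)
    ≡⟨ cong (ind (distinct z) *_) (mult-allVecs n n z) ⟩
  ind (distinct z) * ind ((length z ≡ᵇ n) ∧ allB (λ y → y <ᵇ n) z)
    ≡⟨ regroup (distinct z) (length z ≡ᵇ n) (allB (λ y → y <ᵇ n) z) ⟩
  ind (isPermB n z) ∎
  where
  distinct-transfer : ∀ w → ind (does (distinct w Bool.≟ true)) * ind (does (z ≟ʷ w)) ≡ ind (distinct z) * ind (does (z ≟ʷ w))
  distinct-transfer w with z ≟ʷ w
  ... | no _     = trans (ℕP.*-zeroʳ (ind (does (distinct w Bool.≟ true)))) (sym (ℕP.*-zeroʳ (ind (distinct z))))
  ... | yes refl with distinct z
  ...   | true  = refl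
  ...   | false = refl
  regroup : ∀ d a b → ind d * ind (a ∧ b) ≡ ind (a ∧ (b ∧ d))
  regroup d     false b     = ℕP.*-zeroʳ (ind d)
  regroup d     true  false = ℕP.*-zeroʳ (ind d)
  regroup true  true  true  = refl
  regroup false true  true  = refl

permWords-IsPerm : ∀ n → All (IsPerm n) (permWords n)
permWords-IsPerm n = All.tabulate λ {π} π∈ →
  isPermB⇒IsPerm n π (ind≢0 (λ e → ∈⇒mult≢0 π∈ (trans (mult-permWords n π) e)))
  where
  ind≢0 : ∀ {b} → ind b ≢ 0 → b ≡ true
  ind≢0 {true}  _ = refl
  ind≢0 {false} h = ⊥-elim (h refl)

sumL-downFrom : ∀ k (h : ℕ → ℕ) → sumL h (downFrom k) ≡ sumBelow k h
sumL-downFrom zero    h = refl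
sumL-downFrom (suc k) h = trans (cong (h k +_) (sumL-downFrom k h)) (ℕP.+-comm (h k) (sumBelow k h))

-- A bijection between pairs (permutation of m, position i ≤ m) and the
-- permutations of m+1, given by an encoding and its inverse.
record Decomposition (m : ℕ) : Set where
  field
    enc      : List ℕ → ℕ → List ℕ
    dec      : List ℕ → List ℕ × ℕ
    enc-perm : ∀ π i → IsPerm m π → i ≤ m → IsPerm (suc m) (enc π i)
    dec-enc  : ∀ π i → IsPerm m π → i ≤ m → dec (enc π i) ≡ (π , i)
    enc-dec  : ∀ z → IsPerm (suc m) z →
               IsPerm m (proj₁ (dec z)) × proj₂ (dec z) ≤ m × enc (proj₁ (dec z)) (proj₂ (dec z)) ≡ z

module _ {m : ℕ} (d : Decomposition m) where
  open Decomposition d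

  private
    encodings : List (List ℕ)
    encodings = concatMap (λ π → map (enc π) (downFrom (suc m))) (permWords m)

    sumL-encodings : ∀ f → sumL f encodings ≡ sumL (λ π → sumBelow (suc m) (λ i → f (enc π i))) (permWords m)
    sumL-encodings f = trans (sumL-concatMap f _ (permWords m))
      (sumL-cong (permWords m) (λ π → trans (sumL-map f (enc π) (downFrom (suc m))) (sumL-downFrom (suc m) _)))

    mult-encodings-nonperm : ∀ z → isPermB (suc m) z ≡ false → mult z encodings ≡ 0
    mult-encodings-nonperm z notPerm = begin
      mult z encodings                                                         ≡⟨ sumL-encodings _ ⟩
      sumL (λ π → sumBelow (suc m) (λ i → ind (does (z ≟ʷ enc π i)))) (permWords m)
        ≡⟨ sumL-congᴬ (permWords-IsPerm m) (λ π pπ → sumBelow-cong (suc m) (λ i i<1+m → miss π i pπ (ℕP.≤-pred i<1+m))) ⟩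
      sumL (λ π → sumBelow (suc m) (λ _ → 0)) (permWords m)
        ≡⟨ trans (sumL-cong (permWords m) (λ π → sumBelow-zero (suc m))) (sumL-zero (permWords m)) ⟩
      0                                                                        ∎
      where
      miss : ∀ π i → IsPerm m π → i ≤ m → ind (does (z ≟ʷ enc π i)) ≡ 0
      miss π i pπ i≤m with z ≟ʷ enc π i
      ... | no _ = refl
      ... | yes refl with trans (sym notPerm) (IsPerm⇒isPermB (suc m) z (enc-perm π i pπ i≤m))
      ...   | ()

    mult-encodings-perm : ∀ z → IsPerm (suc m) z → mult z encodings ≡ 1
    mult-encodings-perm z pz = begin
      mult z encodings                                                         ≡⟨ sumL-encodings _ ⟩
      sumL (λ π → sumBelow (suc m) (λ i → ind (does (z ≟ʷ enc π i)))) (permWords m)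
        ≡⟨ sumL-congᴬ (permWords-IsPerm m) (λ π pπ → trans
             (sumBelow-cong (suc m) (λ i i<1+m → hit π i pπ (ℕP.≤-pred i<1+m)))
             (sumBelow-scale (suc m) (ind (does (π₀ ≟ʷ π))) _)) ⟩
      sumL (λ π → ind (does (π₀ ≟ʷ π)) * sumBelow (suc m) (λ i → ind (i₀ ≡ᵇ i))) (permWords m)
        ≡⟨ sumL-cong (permWords m) (λ π → trans (cong (ind (does (π₀ ≟ʷ π)) *_) i₀-once) (ℕP.*-identityʳ _)) ⟩
      mult π₀ (permWords m)                                                    ≡⟨ mult-permWords m π₀ ⟩
      ind (isPermB m π₀)                                                       ≡⟨ cong ind (IsPerm⇒isPermB m π₀ π₀-perm) ⟩
      1                                                                        ∎
      where
      π₀ = proj₁ (dec z)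
      i₀ = proj₂ (dec z)
      π₀-perm = proj₁ (enc-dec z pz)
      i₀≤m = proj₁ (proj₂ (enc-dec z pz))
      i₀-once : sumBelow (suc m) (λ i → ind (i₀ ≡ᵇ i)) ≡ 1
      i₀-once = trans (sumBelow-point (suc m) i₀) (cong ind (<ᵇ-complete (s≤s i₀≤m)))
      hit : ∀ π i → IsPerm m π → i ≤ m → ind (does (z ≟ʷ enc π i)) ≡ ind (does (π₀ ≟ʷ π)) * ind (i₀ ≡ᵇ i)
      hit π i pπ i≤m with z ≟ʷ enc π i
      ... | yes refl rewrite dec-enc π i pπ i≤m | dec-true (π ≟ʷ π) refl | ≡ᵇ-refl i = refl
      ... | no z≢ with π₀ ≟ʷ π | i₀ ≡ᵇ i in i₀≟i
      ...   | yes refl | true  = ⊥-elim (z≢ (trans (sym (proj₂ (proj₂ (enc-dec z pz))))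
                                                   (cong (enc π₀) (≡ᵇ-sound i₀ i i₀≟i))))
      ...   | yes _    | false = refl
      ...   | no _     | _     = refl

  -- permWords (suc m) and the encodings have the same multiplicities.
  sum-decompose : ∀ f → sumL f (permWords (suc m)) ≡ sumL (λ π → sumBelow (suc m) (λ i → f (enc π i))) (permWords m)
  sum-decompose f = trans (sumL-rearrange (permWords (suc m)) encodings same-mult f) (sumL-encodings f)
    where
    same-mult : ∀ z → mult z (permWords (suc m)) ≡ mult z encodings
    same-mult z rewrite mult-permWords (suc m) z with isPermB (suc m) z in isPerm
    ... | false = sym (mult-encodings-nonperm z isPerm)
    ... | true  = sym (mult-encodings-perm z (isPermB⇒IsPerm (suc m) z isPerm))

getD : ℕ → ℕ → List ℕ → ℕ
getD d i       []      = d
getD d zero    (x ∷ l) = x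
getD d (suc i) (x ∷ l) = getD d i l

setAt : ℕ → ℕ → List ℕ → List ℕ
setAt i       w []      = []
setAt zero    w (x ∷ l) = w ∷ l
setAt (suc i) w (x ∷ l) = x ∷ setAt i w l

indexOf : ℕ → List ℕ → ℕ
indexOf v []      = 0
indexOf v (x ∷ l) = if v ≡ᵇ x then 0 else suc (indexOf v l)

insAt : ℕ → ℕ → List ℕ → List ℕ
insAt zero    w l       = w ∷ l
insAt (suc j) w []      = w ∷ []
insAt (suc j) w (x ∷ l) = x ∷ insAt j w l

remAt : ℕ → List ℕ → List ℕ
remAt p       []      = []
remAt zero    (x ∷ l) = l
remAt (suc p) (x ∷ l) = x ∷ remAt p l

initL : List ℕ → List ℕ
initL []          = []
initL (x ∷ [])    = []
initL (x ∷ y ∷ l) = x ∷ initL (y ∷ l)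

lastL : List ℕ → ℕ
lastL []          = 0
lastL (x ∷ [])    = x
lastL (x ∷ y ∷ l) = lastL (y ∷ l)

occ-++ : ∀ v A B → occ v (A ++ B) ≡ occ v A + occ v B
occ-++ v = sumL-++ _

occ-snoc : ∀ v l x → occ v (l ++ [ x ]) ≡ occ v l + ind (v ≡ᵇ x)
occ-snoc v l x = trans (occ-++ v l [ x ]) (cong (occ v l +_) (ℕP.+-identityʳ _))

length-snoc : ∀ (l : List ℕ) x → length (l ++ [ x ]) ≡ suc (length l)
length-snoc l x = trans (ListP.length-++ l) (ℕP.+-comm (length l) 1)

occ-setAt : ∀ d v i w l → i < length l → occ v (setAt i w l) + ind (v ≡ᵇ getD d i l) ≡ occ v l + ind (v ≡ᵇ w)
occ-setAt d v zero    w (x ∷ l) _ = regroup (ind (v ≡ᵇ w)) (occ v l) (ind (v ≡ᵇ x))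
  where regroup : ∀ a b c → a + b + c ≡ c + b + a
        regroup = solve-∀
occ-setAt d v (suc i) w (x ∷ l) (s≤s i<) =
  trans (ℕP.+-assoc (ind (v ≡ᵇ x)) _ _)
        (trans (cong (ind (v ≡ᵇ x) +_) (occ-setAt d v i w l i<)) (sym (ℕP.+-assoc (ind (v ≡ᵇ x)) _ _)))

setAt-beyond : ∀ i w l → length l ≤ i → setAt i w l ≡ l
setAt-beyond i       w []      _       = refl
setAt-beyond (suc i) w (x ∷ l) (s≤s h) = cong (x ∷_) (setAt-beyond i w l h)

getD-beyond : ∀ d i l → length l ≤ i → getD d i l ≡ d
getD-beyond d i       []      _       = refl
getD-beyond d (suc i) (x ∷ l) (s≤s h) = getD-beyond d i l h

length-setAt : ∀ i w l → length (setAt i w l) ≡ length l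
length-setAt i       w []      = refl
length-setAt zero    w (x ∷ l) = refl
length-setAt (suc i) w (x ∷ l) = cong suc (length-setAt i w l)

setAt-setAt : ∀ i w u l → setAt i w (setAt i u l) ≡ setAt i w l
setAt-setAt i       w u []      = refl
setAt-setAt zero    w u (x ∷ l) = refl
setAt-setAt (suc i) w u (x ∷ l) = cong (x ∷_) (setAt-setAt i w u l)

setAt-getD : ∀ d i l → setAt i (getD d i l) l ≡ l
setAt-getD d i       []      = refl
setAt-getD d zero    (x ∷ l) = refl
setAt-getD d (suc i) (x ∷ l) = cong (x ∷_) (setAt-getD d i l)

getD-setAt : ∀ d i w l → i < length l → getD d i (setAt i w l) ≡ w
getD-setAt d zero    w (x ∷ l) _       = refl
getD-setAt d (suc i) w (x ∷ l) (s≤s h) = getD-setAt d i w l h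

indexOf-setAt : ∀ v i l r → occ v l ≡ 0 → i < length l → indexOf v (setAt i v l ++ r) ≡ i
indexOf-setAt v zero    (x ∷ l) r _ _ rewrite ≡ᵇ-refl v = refl
indexOf-setAt v (suc i) (x ∷ l) r h (s≤s i<) with occ-head0 v x l h
... | v≢x , h' rewrite v≢x = cong suc (indexOf-setAt v i l r h' i<)

indexOf-snoc : ∀ v l r → occ v l ≡ 0 → indexOf v (l ++ v ∷ r) ≡ length l
indexOf-snoc v []      r _ rewrite ≡ᵇ-refl v = refl
indexOf-snoc v (x ∷ l) r h with occ-head0 v x l h
... | v≢x , h' rewrite v≢x = cong suc (indexOf-snoc v l r h')

indexOf-insAt : ∀ v j l → occ v l ≡ 0 → j ≤ length l → indexOf v (insAt j v l) ≡ j
indexOf-insAt v zero    l       _ _ rewrite ≡ᵇ-refl v = refl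
indexOf-insAt v (suc j) (x ∷ l) h (s≤s j≤) with occ-head0 v x l h
... | v≢x , h' rewrite v≢x = cong suc (indexOf-insAt v j l h' j≤)

indexOf-++ : ∀ v l r → 1 ≤ occ v l → indexOf v (l ++ r) ≡ indexOf v l
indexOf-++ v (x ∷ l) r h with v ≡ᵇ x
... | true  = refl
... | false = cong suc (indexOf-++ v l r h)

indexOf-< : ∀ v l → 1 ≤ occ v l → indexOf v l < length l
indexOf-< v (x ∷ l) h with v ≡ᵇ x
... | true  = s≤s z≤n
... | false = s≤s (indexOf-< v l h)

getD-indexOf : ∀ d v l → 1 ≤ occ v l → getD d (indexOf v l) l ≡ v
getD-indexOf d v (x ∷ l) h with v ≡ᵇ x in v≟x
... | true  = sym (≡ᵇ-sound v x v≟x)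
... | false = getD-indexOf d v l h

init-last : ∀ z → 1 ≤ length z → z ≡ initL z ++ [ lastL z ]
init-last (x ∷ [])    _ = refl
init-last (x ∷ y ∷ l) _ = cong (x ∷_) (init-last (y ∷ l) (s≤s z≤n))

initL-snoc : ∀ l x → initL (l ++ [ x ]) ≡ l
initL-snoc []          x = refl
initL-snoc (y ∷ [])    x = refl
initL-snoc (y ∷ z ∷ l) x = cong (y ∷_) (initL-snoc (z ∷ l) x)

lastL-snoc : ∀ l x → lastL (l ++ [ x ]) ≡ x
lastL-snoc []          x = refl
lastL-snoc (y ∷ [])    x = refl
lastL-snoc (y ∷ z ∷ l) x = lastL-snoc (z ∷ l) x

length-insAt : ∀ j w l → length (insAt j w l) ≡ suc (length l)
length-insAt zero    w l       = refl
length-insAt (suc j) w []      = refl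
length-insAt (suc j) w (x ∷ l) = cong suc (length-insAt j w l)

occ-insAt : ∀ v j w l → occ v (insAt j w l) ≡ ind (v ≡ᵇ w) + occ v l
occ-insAt v zero    w l       = refl
occ-insAt v (suc j) w []      = refl
occ-insAt v (suc j) w (x ∷ l) =
  trans (cong (ind (v ≡ᵇ x) +_) (occ-insAt v j w l)) (+-left-comm (ind (v ≡ᵇ x)) (ind (v ≡ᵇ w)) (occ v l))

insAt-end : ∀ w l → insAt (length l) w l ≡ l ++ [ w ]
insAt-end w []      = refl
insAt-end w (x ∷ l) = cong (x ∷_) (insAt-end w l)

remAt-insAt : ∀ j w l → j ≤ length l → remAt j (insAt j w l) ≡ l
remAt-insAt zero    w l       _       = refl
remAt-insAt (suc j) w (x ∷ l) (s≤s h) = cong (x ∷_) (remAt-insAt j w l h)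

insAt-remAt : ∀ d p z → p < length z → insAt p (getD d p z) (remAt p z) ≡ z
insAt-remAt d zero    (x ∷ z)     _       = refl
insAt-remAt d (suc p) (x ∷ y ∷ z) (s≤s h) = cong (x ∷_) (insAt-remAt d p (y ∷ z) h)

occ-remAt : ∀ d v p z → p < length z → occ v (remAt p z) + ind (v ≡ᵇ getD d p z) ≡ occ v z
occ-remAt d v zero    (x ∷ z) _       = ℕP.+-comm (occ v z) _
occ-remAt d v (suc p) (x ∷ z) (s≤s h) =
  trans (ℕP.+-assoc (ind (v ≡ᵇ x)) _ _) (cong (ind (v ≡ᵇ x) +_) (occ-remAt d v p z h))

length-remAt : ∀ p z → p < length z → suc (length (remAt p z)) ≡ length z
length-remAt zero    (x ∷ z) _       = refl
length-remAt (suc p) (x ∷ z) (s≤s h) = cong suc (length-remAt p z h)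

IsPerm-max-absent : ∀ m π → IsPerm m π → occ m π ≡ 0
IsPerm-max-absent m π (_ , occurrences) = trans (occurrences m) (cong ind (<ᵇ-irrefl m))

insertionDecomposition : ∀ m → Decomposition m
insertionDecomposition m = record
  { enc      = λ π j → insAt j m π
  ; dec      = λ z → remAt (indexOf m z) z , indexOf m z
  ; enc-perm = enc-perm
  ; dec-enc  = dec-enc
  ; enc-dec  = enc-dec
  }
  where
  enc-perm : ∀ π j → IsPerm m π → j ≤ m → IsPerm (suc m) (insAt j m π)
  enc-perm π j (len , occurrences) _ = trans (length-insAt j m π) (cong suc len) , λ v → begin
    occ v (insAt j m π)               ≡⟨ occ-insAt v j m π ⟩
    ind (v ≡ᵇ m) + occ v π            ≡⟨ cong (ind (v ≡ᵇ m) +_) (occurrences v) ⟩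
    ind (v ≡ᵇ m) + ind (v <ᵇ m)       ≡⟨ ℕP.+-comm (ind (v ≡ᵇ m)) _ ⟩
    ind (v <ᵇ m) + ind (v ≡ᵇ m)       ≡⟨ ind-<ᵇ-suc v m ⟩
    ind (v <ᵇ suc m)                  ∎

  dec-enc : ∀ π j → IsPerm m π → j ≤ m → (remAt (indexOf m (insAt j m π)) (insAt j m π) , indexOf m (insAt j m π)) ≡ (π , j)
  dec-enc π j pπ j≤m
    rewrite indexOf-insAt m j π (IsPerm-max-absent m π pπ) (subst (j ≤_) (sym (proj₁ pπ)) j≤m) =
    cong (_, j) (remAt-insAt j m π (subst (j ≤_) (sym (proj₁ pπ)) j≤m))

  enc-dec : ∀ z → IsPerm (suc m) z →
    IsPerm m (remAt (indexOf m z) z) × indexOf m z ≤ m × insAt (indexOf m z) m (remAt (indexOf m z) z) ≡ z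
  enc-dec z (len , occurrences) = (ℕP.suc-injective (trans (length-remAt p z p<) len) , occ-rest) , ℕP.≤-pred (subst (p <_) len p<) , reinsert
    where
    m-occurs : 1 ≤ occ m z
    m-occurs = subst (1 ≤_) (sym (trans (occurrences m) (cong ind (<ᵇ-complete (ℕP.n<1+n m))))) (s≤s z≤n)
    p = indexOf m z
    p< : p < length z
    p< = indexOf-< m z m-occurs
    at-p : getD m p z ≡ m
    at-p = getD-indexOf m m z m-occurs
    occ-rest : ∀ v → occ v (remAt p z) ≡ ind (v <ᵇ m)
    occ-rest v = ℕP.+-cancelʳ-≡ _ (occ v (remAt p z)) (ind (v <ᵇ m)) (begin
      occ v (remAt p z) + ind (v ≡ᵇ m)         ≡⟨ cong (λ t → occ v (remAt p z) + ind (v ≡ᵇ t)) (sym at-p) ⟩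
      occ v (remAt p z) + ind (v ≡ᵇ getD m p z) ≡⟨ occ-remAt m v p z p< ⟩
      occ v z                                   ≡⟨ occurrences v ⟩
      ind (v <ᵇ suc m)                          ≡⟨ sym (ind-<ᵇ-suc v m) ⟩
      ind (v <ᵇ m) + ind (v ≡ᵇ m)               ∎)
    reinsert : insAt p m (remAt p z) ≡ z
    reinsert = trans (cong (λ t → insAt p t (remAt p z)) (sym at-p)) (insAt-remAt m p z p<)

-- Placing the new maximum m at position i ≤ m and appending the entry it
-- displaces.  For i < m this is the one-line word of π·(i m); for i = m it
-- just appends m.
transpose : ℕ → List ℕ → ℕ → List ℕ
transpose m π i = setAt i m π ++ [ getD m i π ]

untranspose : ℕ → List ℕ → List ℕ × ℕ
untranspose m z = setAt (indexOf m z) (lastL z) (initL z) , indexOf m z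

transpose-perm : ∀ m π i → IsPerm m π → i ≤ m → IsPerm (suc m) (transpose m π i)
transpose-perm m π i (len , occurrences) i≤m =
  trans (length-snoc (setAt i m π) _) (cong suc (trans (length-setAt i m π) len)) , λ v → begin
    occ v (setAt i m π ++ [ getD m i π ])           ≡⟨ occ-snoc v (setAt i m π) _ ⟩
    occ v (setAt i m π) + ind (v ≡ᵇ getD m i π)     ≡⟨ swap v ⟩
    occ v π + ind (v ≡ᵇ m)                          ≡⟨ cong (_+ ind (v ≡ᵇ m)) (occurrences v) ⟩
    ind (v <ᵇ m) + ind (v ≡ᵇ m)                     ≡⟨ ind-<ᵇ-suc v m ⟩
    ind (v <ᵇ suc m)                                ∎
  where
  swap : ∀ v → occ v (setAt i m π) + ind (v ≡ᵇ getD m i π) ≡ occ v π + ind (v ≡ᵇ m)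
  swap v with ℕP.m≤n⇒m<n∨m≡n i≤m
  ... | inj₁ i<m  = occ-setAt m v i m π (subst (i <_) (sym len) i<m)
  ... | inj₂ refl rewrite setAt-beyond i m π (ℕP.≤-reflexive len) | getD-beyond i i π (ℕP.≤-reflexive len) = refl

indexOf-transpose : ∀ m π i → IsPerm m π → i ≤ m → indexOf m (transpose m π i) ≡ i
indexOf-transpose m π i pπ@(len , _) i≤m with ℕP.m≤n⇒m<n∨m≡n i≤m
... | inj₁ i<m  = indexOf-setAt m i π _ (IsPerm-max-absent m π pπ) (subst (i <_) (sym len) i<m)
... | inj₂ refl rewrite setAt-beyond i i π (ℕP.≤-reflexive len) | getD-beyond i i π (ℕP.≤-reflexive len) =
  trans (indexOf-snoc i π [] (IsPerm-max-absent i π pπ)) len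

untranspose-transpose : ∀ m π i → IsPerm m π → i ≤ m → untranspose m (transpose m π i) ≡ (π , i)
untranspose-transpose m π i pπ i≤m
  rewrite initL-snoc (setAt i m π) (getD m i π) | lastL-snoc (setAt i m π) (getD m i π) | indexOf-transpose m π i pπ i≤m =
  cong (_, i) (trans (setAt-setAt i (getD m i π) m π) (setAt-getD m i π))

module _ (m : ℕ) (z : List ℕ) (pz : IsPerm (suc m) z) where
  private
    ini = initL z
    w   = lastL z
    p   = indexOf m z

    Inverse : Set
    Inverse = IsPerm m (setAt p w ini) × p ≤ m × transpose m (setAt p w ini) p ≡ z

    z≡ : z ≡ ini ++ [ w ]
    z≡ = init-last z (subst (1 ≤_) (sym (proj₁ pz)) (s≤s z≤n))

    length-ini : length ini ≡ m
    length-ini = ℕP.suc-injective (trans (sym (length-snoc ini w)) (trans (cong length (sym z≡)) (proj₁ pz)))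

    occ-ini : ∀ v → occ v ini + ind (v ≡ᵇ w) ≡ ind (v <ᵇ m) + ind (v ≡ᵇ m)
    occ-ini v = trans (sym (occ-snoc v ini w)) (trans (cong (occ v) (sym z≡)) (trans (proj₂ pz v) (sym (ind-<ᵇ-suc v m))))

    m-inside : 1 ≤ occ m ini → Inverse
    m-inside m∈ = (trans (length-setAt p w ini) length-ini , occ-π) , ℕP.<⇒≤ p<m , reencode
      where
      p≡ : p ≡ indexOf m ini
      p≡ = trans (cong (indexOf m) z≡) (indexOf-++ m ini [ w ] m∈)
      p<m : p < m
      p<m = subst (_< m) (sym p≡) (subst (indexOf m ini <_) length-ini (indexOf-< m ini m∈))
      p<len : p < length ini
      p<len = subst (p <_) (sym length-ini) p<m
      at-p : getD m p ini ≡ m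
      at-p = trans (cong (λ q → getD m q ini) p≡) (getD-indexOf m m ini m∈)
      occ-π : ∀ v → occ v (setAt p w ini) ≡ ind (v <ᵇ m)
      occ-π v = ℕP.+-cancelʳ-≡ _ (occ v (setAt p w ini)) (ind (v <ᵇ m))
                 (trans (cong (λ t → occ v (setAt p w ini) + ind (v ≡ᵇ t)) (sym at-p))
                 (trans (occ-setAt m v p w ini p<len) (occ-ini v)))
      reencode : transpose m (setAt p w ini) p ≡ z
      reencode = begin
        setAt p m (setAt p w ini) ++ [ getD m p (setAt p w ini) ]
          ≡⟨ cong₂ (λ a b → a ++ [ b ]) (setAt-setAt p m w ini) (getD-setAt m p w ini p<len) ⟩
        setAt p m ini ++ [ w ]                  ≡⟨ cong (λ t → setAt p t ini ++ [ w ]) (sym at-p) ⟩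
        setAt p (getD m p ini) ini ++ [ w ]     ≡⟨ cong (_++ [ w ]) (setAt-getD m p ini) ⟩
        ini ++ [ w ]                            ≡⟨ sym z≡ ⟩
        z                                       ∎

    m-last : occ m ini ≡ 0 → Inverse
    m-last m∉ = (trans (length-setAt p w ini) length-ini , occ-π) , ℕP.≤-reflexive p≡m , reencode
      where
      w≡m : w ≡ m
      w≡m with m ≡ᵇ w in m≟w
      ... | true  = sym (≡ᵇ-sound m w m≟w)
      ... | false = ⊥-elim (ℕP.0≢1+n (begin
        0                             ≡⟨ cong ind (sym m≟w) ⟩
        ind (m ≡ᵇ w)                  ≡⟨ cong (_+ ind (m ≡ᵇ w)) (sym m∉) ⟩
        occ m ini + ind (m ≡ᵇ w)      ≡⟨ occ-ini m ⟩
        ind (m <ᵇ m) + ind (m ≡ᵇ m)   ≡⟨ cong₂ (λ a b → ind a + ind b) (<ᵇ-irrefl m) (≡ᵇ-refl m) ⟩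
        1                             ∎))
      p≡m : p ≡ m
      p≡m = trans (cong (indexOf m) z≡) (trans (cong (λ t → indexOf m (ini ++ [ t ])) w≡m)
                (trans (indexOf-snoc m ini [] m∉) length-ini))
      unchanged : setAt p w ini ≡ ini
      unchanged = setAt-beyond p w ini (ℕP.≤-reflexive (trans length-ini (sym p≡m)))
      occ-π : ∀ v → occ v (setAt p w ini) ≡ ind (v <ᵇ m)
      occ-π v rewrite unchanged = ℕP.+-cancelʳ-≡ _ (occ v ini) (ind (v <ᵇ m))
        (trans (cong (λ t → occ v ini + ind (v ≡ᵇ t)) (sym w≡m)) (occ-ini v))
      reencode : transpose m (setAt p w ini) p ≡ z
      reencode rewrite unchanged | p≡m = trans
        (cong₂ (λ a b → a ++ [ b ]) (setAt-beyond m m ini (ℕP.≤-reflexive length-ini))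
                                    (trans (getD-beyond m m ini (ℕP.≤-reflexive length-ini)) (sym w≡m)))
        (sym z≡)

  transpose-untranspose : Inverse
  transpose-untranspose with occ m ini in m∈?
  ... | suc _ = m-inside (subst (1 ≤_) (sym m∈?) (s≤s z≤n))
  ... | zero  = m-last m∈?

transpositionDecomposition : ∀ m → Decomposition m
transpositionDecomposition m = record
  { enc      = transpose m
  ; dec      = untranspose m
  ; enc-perm = transpose-perm m
  ; dec-enc  = untranspose-transpose m
  ; enc-dec  = transpose-untranspose m
  }

posCount : (ℕ → ℕ → Bool) → ℕ → List ℕ → ℕ
posCount p k []      = 0
posCount p k (x ∷ l) = ind (p k x) + posCount p (suc k) l

excW nexcW : List ℕ → ℕ
excW  = posCount (λ i x → i <ᵇ x) 0
nexcW = posCount (λ i x → not (i <ᵇ x)) 0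

posCount-shift : ∀ p k l → posCount p (suc k) l ≡ posCount (λ i → p (suc i)) k l
posCount-shift p k []      = refl
posCount-shift p k (x ∷ l) = cong (ind (p (suc k) x) +_) (posCount-shift p (suc k) l)

posCount-++ : ∀ p k A C → posCount p k (A ++ C) ≡ posCount p k A + posCount p (k + length A) C
posCount-++ p k []      C = cong (λ t → posCount p t C) (sym (ℕP.+-identityʳ k))
posCount-++ p k (x ∷ A) C rewrite posCount-++ p (suc k) A C | ℕP.+-suc k (length A) =
  sym (ℕP.+-assoc (ind (p k x)) _ _)

posCount-sumBelow : ∀ p l → posCount p 0 l ≡ sumBelow (length l) (λ i → ind (p i (getD 0 i l)))
posCount-sumBelow p []      = refl
posCount-sumBelow p (x ∷ l) = begin
  ind (p 0 x) + posCount p 1 l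
    ≡⟨ cong (ind (p 0 x) +_) (trans (posCount-shift p 0 l) (posCount-sumBelow (λ i → p (suc i)) l)) ⟩
  ind (p 0 x) + sumBelow (length l) (λ i → ind (p (suc i) (getD 0 i l)))
    ≡⟨ sym (sumBelow-shift (length l) (λ i → ind (p i (getD 0 i (x ∷ l))))) ⟩
  sumBelow (length (x ∷ l)) (λ i → ind (p i (getD 0 i (x ∷ l)))) ∎

posCount-vec : ∀ p {n k} (π : Vec (Fin n) k) →
  sumL (λ i → ind (p (toℕ i) (toℕ (lookup π i)))) (allFin k) ≡ posCount p 0 (word π)
posCount-vec p []ᵥ                 = refl
posCount-vec p {k = suc k} (x ∷ᵥ π) = cong (ind (p 0 (toℕ x)) +_) (begin
  sumL (λ i → ind (p (toℕ i) (toℕ (lookup (x ∷ᵥ π) i)))) (tabulate fsuc)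
    ≡⟨ sumL-tabulate {n = k} fsuc (λ i → ind (p (toℕ i) (toℕ (lookup (x ∷ᵥ π) i)))) ⟩
  sumL (λ i → ind (p (suc (toℕ i)) (toℕ (lookup π i)))) (allFin k)
    ≡⟨ posCount-vec (λ i → p (suc i)) π ⟩
  posCount (λ i → p (suc i)) 0 (word π)
    ≡⟨ sym (posCount-shift p 0 (word π)) ⟩
  posCount p 1 (word π) ∎)

exc≡excW : ∀ {n} (π : Vec (Fin n) n) → exc π ≡ excW (vals π)
exc≡excW {n} π = trans (countB≡sumL _ (allFin n)) (posCount-vec (λ i x → i <ᵇ x) π)

nexc≡nexcW : ∀ {n} (π : Vec (Fin n) n) → nexc π ≡ nexcW (vals π)
nexc≡nexcW {n} π = trans (countB≡sumL _ (allFin n)) (posCount-vec (λ i x → not (i <ᵇ x)) π)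

posCount-transpose : ∀ p A x g B →
  posCount p 0 (A ++ x ∷ (B ++ [ g ])) + ind (p (length A) g)
    ≡ posCount p 0 (A ++ g ∷ B) + ind (p (length A) x) + ind (p (suc (length A) + length B) g)
posCount-transpose p A x g B = begin
  posCount p 0 (A ++ x ∷ (B ++ [ g ])) + ind (p (length A) g)
    ≡⟨ cong (_+ ind (p (length A) g)) (posCount-++ p 0 A (x ∷ (B ++ [ g ]))) ⟩
  posCount p 0 A + (ind (p (length A) x) + posCount p (suc (length A)) (B ++ [ g ])) + ind (p (length A) g)
    ≡⟨ cong (λ t → posCount p 0 A + (ind (p (length A) x) + t) + ind (p (length A) g))
            (posCount-++ p (suc (length A)) B [ g ]) ⟩
  posCount p 0 A + (ind (p (length A) x) + (posCount p (suc (length A)) B + (ind (p (suc (length A) + length B) g) + 0)))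
    + ind (p (length A) g)
    ≡⟨ regroup (posCount p 0 A) (ind (p (length A) x)) (posCount p (suc (length A)) B)
               (ind (p (suc (length A) + length B) g)) (ind (p (length A) g)) ⟩
  posCount p 0 A + (ind (p (length A) g) + posCount p (suc (length A)) B) + ind (p (length A) x)
    + ind (p (suc (length A) + length B) g)
    ≡⟨ cong (λ t → t + ind (p (length A) x) + ind (p (suc (length A) + length B) g))
            (sym (posCount-++ p 0 A (g ∷ B))) ⟩
  posCount p 0 (A ++ g ∷ B) + ind (p (length A) x) + ind (p (suc (length A) + length B) g) ∎
  where regroup : ∀ a x b y g → a + (x + (b + (y + 0))) + g ≡ a + (g + b) + x + y
        regroup = solve-∀

below above : ℕ → List ℕ → ℕ
below a = sumL (λ y → ind (y <ᵇ a))
above a = sumL (λ y → ind (a <ᵇ y))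

crossInv : List ℕ → List ℕ → ℕ
crossInv A C = sumL (λ a → below a C) A

invL-∷ : ∀ x xs → invL (x ∷ xs) ≡ below x xs + invL xs
invL-∷ x xs = cong (_+ invL xs) (countB≡sumL _ xs)

invL-++ : ∀ A C → invL (A ++ C) ≡ invL A + crossInv A C + invL C
invL-++ []      C = refl
invL-++ (x ∷ A) C = begin
  invL (x ∷ A ++ C)                                      ≡⟨ invL-∷ x (A ++ C) ⟩
  below x (A ++ C) + invL (A ++ C)                       ≡⟨ cong₂ _+_ (sumL-++ _ A C) (invL-++ A C) ⟩
  below x A + below x C + (invL A + crossInv A C + invL C)
    ≡⟨ regroup (below x A) (below x C) (invL A) (crossInv A C) (invL C) ⟩
  (below x A + invL A) + (below x C + crossInv A C) + invL C
    ≡⟨ cong (λ t → t + (below x C + crossInv A C) + invL C) (sym (invL-∷ x A)) ⟩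
  invL (x ∷ A) + crossInv (x ∷ A) C + invL C             ∎
  where regroup : ∀ a b c d e → a + b + (c + d + e) ≡ (a + c) + (b + d) + e
        regroup = solve-∀

crossInv-++ : ∀ A C D → crossInv A (C ++ D) ≡ crossInv A C + crossInv A D
crossInv-++ A C D = trans (sumL-cong A (λ a → sumL-++ _ C D)) (sumL-+ (λ a → below a C) (λ a → below a D) A)

below-all : ∀ a C → allB (λ y → y <ᵇ a) C ≡ true → below a C ≡ length C
below-all a []      _ = refl
below-all a (x ∷ C) h with ∧-true {x <ᵇ a} h
... | x<a , rest rewrite x<a = cong suc (below-all a C rest)

crossInv-max : ∀ m A → allB (λ y → y <ᵇ m) A ≡ true → crossInv A [ m ] ≡ 0
crossInv-max m []      _ = refl
crossInv-max m (x ∷ A) h with ∧-true {x <ᵇ m} h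
... | x<m , rest rewrite <ᵇ-false {m} {x} (ℕP.<⇒≤ (<ᵇ-sound x m x<m)) = crossInv-max m A rest

length-split : ∀ g B → occ g B ≡ 0 → length B ≡ below g B + above g B
length-split g []      _ = refl
length-split g (x ∷ B) h with occ-head0 g x B h
... | g≢x , h' = begin
  suc (length B)                                   ≡⟨ cong suc (length-split g B h') ⟩
  1 + (below g B + above g B)
    ≡⟨ cong (_+ (below g B + above g B)) (sym (trans (ℕP.+-comm (ind (x <ᵇ g)) _) (<ᵇ-trichotomy g x g≢x))) ⟩
  ind (x <ᵇ g) + ind (g <ᵇ x) + (below g B + above g B)
    ≡⟨ +-interchange (ind (x <ᵇ g)) (ind (g <ᵇ x)) (below g B) (above g B) ⟩
  below g (x ∷ B) + above g (x ∷ B)                ∎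

allB-++ : (p : ℕ → Bool) (A B : List ℕ) → allB p (A ++ B) ≡ allB p A ∧ allB p B
allB-++ p []      B = refl
allB-++ p (x ∷ A) B rewrite allB-++ p A B = sym (BoolP.∧-assoc (p x) (allB p A) (allB p B))

invL-transpose : ∀ A g B m → allB (λ y → y <ᵇ m) A ≡ true → allB (λ y → y <ᵇ m) B ≡ true → g < m → occ g B ≡ 0 →
  invL (A ++ m ∷ (B ++ [ g ])) ≡ invL (A ++ g ∷ B) + suc (above g B + above g B)
invL-transpose A g B m A<m B<m g<m g∉B = begin
  invL (A ++ m ∷ (B ++ [ g ]))
    ≡⟨ invL-++ A (m ∷ (B ++ [ g ])) ⟩
  invL A + crossInv A ([ m ] ++ (B ++ [ g ])) + invL (m ∷ (B ++ [ g ]))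
    ≡⟨ cong₂ (λ s t → invL A + s + t)
         (trans (crossInv-++ A [ m ] (B ++ [ g ])) (cong₂ _+_ (crossInv-max m A A<m) (crossInv-++ A B [ g ])))
         (trans (invL-∷ m (B ++ [ g ])) (cong₂ _+_ (trans (below-all m (B ++ [ g ]) Bg<m) (length-snoc B g)) (invL-++ B [ g ]))) ⟩
  invL A + (0 + (crossInv A B + crossInv A [ g ])) + (suc (length B) + (invL B + crossInv B [ g ] + 0))
    ≡⟨ cong₂ (λ s t → invL A + (0 + (crossInv A B + crossInv A [ g ])) + (suc s + (invL B + t + 0)))
             (length-split g B g∉B) (sumL-cong B (λ b → ℕP.+-identityʳ _)) ⟩
  invL A + (0 + (crossInv A B + crossInv A [ g ])) + (suc (below g B + above g B) + (invL B + above g B + 0))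
    ≡⟨ regroup (invL A) (crossInv A B) (crossInv A [ g ]) (below g B) (above g B) (invL B) ⟩
  invL A + (crossInv A [ g ] + crossInv A B) + (below g B + invL B) + suc (above g B + above g B)
    ≡⟨ cong₂ (λ s t → invL A + s + t + suc (above g B + above g B)) (sym (crossInv-++ A [ g ] B)) (sym (invL-∷ g B)) ⟩
  invL A + crossInv A (g ∷ B) + invL (g ∷ B) + suc (above g B + above g B)
    ≡⟨ cong (_+ suc (above g B + above g B)) (sym (invL-++ A (g ∷ B))) ⟩
  invL (A ++ g ∷ B) + suc (above g B + above g B) ∎
  where
  Bg<m : allB (λ y → y <ᵇ m) (B ++ [ g ]) ≡ true
  Bg<m = trans (allB-++ _ B [ g ]) (cong₂ _∧_ B<m (cong (_∧ true) (<ᵇ-complete g<m)))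
  regroup : ∀ a x y p q r → a + (0 + (x + y)) + (suc (p + q) + (r + q + 0)) ≡ a + (y + x) + (p + r) + suc (q + q)
  regroup = solve-∀

isEven-suc : ∀ x → isEven (suc x) ≡ not (isEven x)
isEven-suc zero          = refl
isEven-suc (suc zero)    = refl
isEven-suc (suc (suc x)) = isEven-suc x

isEven-+-odd : ∀ x c → isEven (x + suc (c + c)) ≡ not (isEven x)
isEven-+-odd x c = begin
  isEven (x + suc (c + c))  ≡⟨ cong isEven (trans (ℕP.+-suc x (c + c)) (cong suc (ℕP.+-comm x (c + c)))) ⟩
  isEven (suc (c + c + x))  ≡⟨ isEven-suc (c + c + x) ⟩
  not (isEven (c + c + x))  ≡⟨ cong not (double c) ⟩
  not (isEven x)            ∎
  where
  double : ∀ c → isEven (c + c + x) ≡ isEven x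
  double zero    = refl
  double (suc c) rewrite ℕP.+-suc c c = double c

record SplitAt (i : ℕ) (l : List ℕ) : Set where
  field
    A B     : List ℕ
    g       : ℕ
    l≡      : l ≡ A ++ g ∷ B
    length-A : length A ≡ i
    setAt≡  : ∀ w → setAt i w l ≡ A ++ w ∷ B
    getD≡   : ∀ d → getD d i l ≡ g

splitAt : ∀ i l → i < length l → SplitAt i l
splitAt zero    (x ∷ l) _       = record
  { A = [] ; B = l ; g = x ; l≡ = refl ; length-A = refl ; setAt≡ = λ _ → refl ; getD≡ = λ _ → refl }
splitAt (suc i) (x ∷ l) (s≤s h) = record
  { A = x ∷ A ; B = B ; g = g ; l≡ = cong (x ∷_) l≡ ; length-A = cong suc length-A
  ; setAt≡ = λ w → cong (x ∷_) (setAt≡ w) ; getD≡ = getD≡ }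
  where open SplitAt (splitAt i l h)

sexp : List ℕ → ℕ
sexp l = nexcW l ∸ 1

even : List ℕ → Bool
even l = isEven (invL l)

-- Effect of transposing position i < m with the new maximum: the sign
-- flips, position i (now holding m) is an excedance, the last position m is
-- not, so exc and nexc each gain one minus the contribution of position i in π.
module TransposeAt (m : ℕ) (π : List ℕ) (pπ : IsPerm m π) (i : ℕ) (i<m : i < m) where
  open SplitAt (splitAt i π (subst (i <_) (sym (proj₁ pπ)) i<m)) public

  private
    π<m : allB (λ y → y <ᵇ m) (A ++ g ∷ B) ≡ true
    π<m = subst (λ l → allB (λ y → y <ᵇ m) l ≡ true) l≡ (IsPerm-bounded m π pπ)

    parts : allB (λ y → y <ᵇ m) A ≡ true × (g <ᵇ m) ≡ true × allB (λ y → y <ᵇ m) B ≡ true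
    parts with ∧-true {allB (λ y → y <ᵇ m) A} (trans (sym (allB-++ _ A (g ∷ B))) π<m)
    ... | A<m , gB<m with ∧-true {g <ᵇ m} gB<m
    ... | g<m , B<m = A<m , g<m , B<m

  g<m : g < m
  g<m = <ᵇ-sound g m (proj₁ (proj₂ parts))

  private
    last-position : suc (length A) + length B ≡ m
    last-position = trans (sym (ℕP.+-suc (length A) (length B)))
      (trans (sym (ListP.length-++ A {g ∷ B})) (trans (cong length (sym l≡)) (proj₁ pπ)))

    g∉B : occ g B ≡ 0
    g∉B = ℕP.n≤0⇒n≡0 (ℕP.+-cancelˡ-≤ 1 _ _ (ℕP.≤-trans (ℕP.m≤n+m (suc (occ g B)) (occ g A)) (ℕP.≤-reflexive once)))
      where
      once : occ g A + suc (occ g B) ≡ 1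
      once = trans (cong (λ t → occ g A + (ind t + occ g B)) (sym (≡ᵇ-refl g)))
               (trans (sym (occ-++ g A (g ∷ B))) (trans (cong (occ g) (sym l≡)) (trans (proj₂ pπ g) (cong ind (<ᵇ-complete g<m)))))

    σ≡ : transpose m π i ≡ A ++ m ∷ (B ++ [ g ])
    σ≡ = trans (cong₂ (λ s t → s ++ [ t ]) (setAt≡ m) (getD≡ m)) (ListP.++-assoc A (m ∷ B) [ g ])

    i<ᵇm : (length A <ᵇ m) ≡ true
    i<ᵇm = <ᵇ-complete (subst (_< m) (sym length-A) i<m)

    m≮ᵇg : (suc (length A) + length B <ᵇ g) ≡ false
    m≮ᵇg = <ᵇ-false (ℕP.≤-trans (ℕP.<⇒≤ g<m) (ℕP.≤-reflexive (sym last-position)))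

  posCount-σ : ∀ p → ind (p (length A) m) + ind (p (suc (length A) + length B) g) ≡ 1 →
    posCount p 0 (transpose m π i) + ind (p i (getD 0 i π)) ≡ posCount p 0 π + 1
  posCount-σ p once = begin
    posCount p 0 (transpose m π i) + ind (p i (getD 0 i π))
      ≡⟨ cong₂ (λ s t → posCount p 0 s + ind (p t (getD 0 i π))) σ≡ (sym length-A) ⟩
    posCount p 0 (A ++ m ∷ (B ++ [ g ])) + ind (p (length A) (getD 0 i π))
      ≡⟨ cong (λ t → posCount p 0 (A ++ m ∷ (B ++ [ g ])) + ind (p (length A) t)) (getD≡ 0) ⟩
    posCount p 0 (A ++ m ∷ (B ++ [ g ])) + ind (p (length A) g)
      ≡⟨ posCount-transpose p A m g B ⟩
    posCount p 0 (A ++ g ∷ B) + ind (p (length A) m) + ind (p (suc (length A) + length B) g)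
      ≡⟨ trans (ℕP.+-assoc (posCount p 0 (A ++ g ∷ B)) _ _) (cong (posCount p 0 (A ++ g ∷ B) +_) once) ⟩
    posCount p 0 (A ++ g ∷ B) + 1
      ≡⟨ cong (λ l → posCount p 0 l + 1) (sym l≡) ⟩
    posCount p 0 π + 1 ∎

  excW-σ : excW (transpose m π i) + ind (i <ᵇ getD 0 i π) ≡ excW π + 1
  excW-σ = posCount-σ (λ i x → i <ᵇ x) (cong₂ (λ s t → ind s + ind t) i<ᵇm m≮ᵇg)

  nexcW-σ : nexcW (transpose m π i) + ind (not (i <ᵇ getD 0 i π)) ≡ nexcW π + 1
  nexcW-σ = posCount-σ (λ i x → not (i <ᵇ x)) (cong₂ (λ s t → ind (not s) + ind (not t)) i<ᵇm m≮ᵇg)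

  even-σ : even (transpose m π i) ≡ not (even π)
  even-σ = begin
    isEven (invL (transpose m π i))                     ≡⟨ cong (λ l → isEven (invL l)) σ≡ ⟩
    isEven (invL (A ++ m ∷ (B ++ [ g ])))
      ≡⟨ cong isEven (invL-transpose A g B m (proj₁ parts) (proj₂ (proj₂ parts)) g<m g∉B) ⟩
    isEven (invL (A ++ g ∷ B) + suc (above g B + above g B)) ≡⟨ isEven-+-odd (invL (A ++ g ∷ B)) (above g B) ⟩
    not (isEven (invL (A ++ g ∷ B)))                    ≡⟨ cong (λ l → not (isEven (invL l))) (sym l≡) ⟩
    not (even π)                                        ∎

module TransposeLast (m : ℕ) (π : List ℕ) (pπ : IsPerm m π) where
  private
    σ≡ : transpose m π m ≡ π ++ [ m ]
    σ≡ = cong₂ (λ s t → s ++ [ t ]) (setAt-beyond m m π (ℕP.≤-reflexive (proj₁ pπ)))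
                                    (getD-beyond m m π (ℕP.≤-reflexive (proj₁ pπ)))

    posCount-σ : ∀ p → posCount p 0 (transpose m π m) ≡ posCount p 0 π + (ind (p m m) + 0)
    posCount-σ p = trans (cong (posCount p 0) σ≡)
      (trans (posCount-++ p 0 π [ m ]) (cong (λ t → posCount p 0 π + (ind (p t m) + 0)) (proj₁ pπ)))

  excW-σ : excW (transpose m π m) ≡ excW π
  excW-σ = trans (posCount-σ _) (trans (cong (λ t → excW π + (ind t + 0)) (<ᵇ-irrefl m)) (ℕP.+-identityʳ _))

  nexcW-σ : nexcW (transpose m π m) ≡ nexcW π + 1
  nexcW-σ = trans (posCount-σ _) (cong (λ t → nexcW π + (ind (not t) + 0)) (<ᵇ-irrefl m))

  even-σ : even (transpose m π m) ≡ even π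
  even-σ = begin
    isEven (invL (transpose m π m))       ≡⟨ cong (λ l → isEven (invL l)) σ≡ ⟩
    isEven (invL (π ++ [ m ]))            ≡⟨ cong isEven (invL-++ π [ m ]) ⟩
    isEven (invL π + crossInv π [ m ] + 0) ≡⟨ cong (λ t → isEven (invL π + t + 0)) (crossInv-max m π (IsPerm-bounded m π pπ)) ⟩
    isEven (invL π + 0 + 0)               ≡⟨ cong isEven (trans (ℕP.+-identityʳ (invL π + 0)) (ℕP.+-identityʳ (invL π))) ⟩
    even π                                ∎

-- A permutation of m+1 has a non-excedance (at its last position).
nexcW-pos : ∀ m π → IsPerm (suc m) π → nexcW π ≡ suc (sexp π)
nexcW-pos m π pπ =
  sym (ℕP.m+[n∸m]≡n {1} {nexcW π} (ℕP.≤-trans (s≤s z≤n) (ℕP.≤-trans (ℕP.m≤n+m _ (nexcW A)) (ℕP.≤-reflexive count))))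
  where
  open TransposeAt (suc m) π pπ m (ℕP.n<1+n m)
  last-nexc : posCount (λ i x → not (i <ᵇ x)) (length A) (g ∷ B) ≡ 1 + posCount (λ i x → not (i <ᵇ x)) (suc (length A)) B
  last-nexc = cong (λ t → ind (not t) + posCount (λ i x → not (i <ᵇ x)) (suc (length A)) B)
                   (trans (cong (_<ᵇ g) length-A) (<ᵇ-false (ℕP.≤-pred g<m)))
  count : nexcW A + (1 + posCount (λ i x → not (i <ᵇ x)) (suc (length A)) B) ≡ nexcW π
  count = trans (cong (nexcW A +_) (sym last-nexc)) (trans (sym (posCount-++ _ 0 A (g ∷ B))) (cong nexcW (sym l≡)))

Coeffs : Set
Coeffs = ℕ → ℕ → ℕ

sMulℕ tMulℕ : Coeffs → Coeffs
sMulℕ F zero    b       = 0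
sMulℕ F (suc a) b       = F a b
tMulℕ F a       zero    = 0
tMulℕ F a       (suc b) = F a b

-- The operator R(P, M) = sP + st ∂ₜM + t ∂ₛ(sM) of both recurrences.
step : Coeffs → Coeffs → Coeffs
step P M a b = sMulℕ P a b + (b * sMulℕ M a b + suc a * tMulℕ M a b)

mono : ℕ → ℕ → ℕ → ℕ → ℕ
mono x y a b = ind ((x ≡ᵇ a) ∧ (y ≡ᵇ b))

distribution : (w u v : List ℕ → ℕ) → List (List ℕ) → Coeffs
distribution w u v xs a b = sumL (λ π → w π * mono (u π) (v π) a b) xs

select-first : ∀ x y → x * 1 + y * 0 ≡ x
select-first x y = trans (cong₂ _+_ (ℕP.*-identityʳ x) (ℕP.*-zeroʳ y)) (ℕP.+-identityʳ x)

select-second : ∀ x y → x * 0 + y * 1 ≡ y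
select-second x y = cong₂ _+_ (ℕP.*-zeroʳ x) (ℕP.*-identityʳ y)

mono-subst : ∀ (f : ℕ → ℕ → ℕ) x y a b → f x y * mono x y a b ≡ f a b * mono x y a b
mono-subst f x y a b with x ≡ᵇ a in x≟a | y ≡ᵇ b in y≟b
... | true  | true  rewrite ≡ᵇ-sound x a x≟a | ≡ᵇ-sound y b y≟b = refl
... | true  | false = trans (ℕP.*-zeroʳ (f x y)) (sym (ℕP.*-zeroʳ (f a b)))
... | false | _     = trans (ℕP.*-zeroʳ (f x y)) (sym (ℕP.*-zeroʳ (f a b)))

sumL-mono-s : ∀ (w u v : List ℕ → ℕ) xs a b →
  sumL (λ π → w π * mono (suc (u π)) (v π) a b) xs ≡ sMulℕ (distribution w u v xs) a b
sumL-mono-s w u v xs zero    b = trans (sumL-cong xs (λ π → ℕP.*-zeroʳ (w π))) (sumL-zero xs)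
sumL-mono-s w u v xs (suc a) b = refl

sumL-mono-t : ∀ (w u v : List ℕ → ℕ) xs a b →
  sumL (λ π → w π * mono (u π) (suc (v π)) a b) xs ≡ tMulℕ (distribution w u v xs) a b
sumL-mono-t w u v xs a zero    =
  trans (sumL-cong xs (λ π → trans (cong (λ t → w π * ind t) (BoolP.∧-zeroʳ (u π ≡ᵇ a))) (ℕP.*-zeroʳ (w π)))) (sumL-zero xs)
sumL-mono-t w u v xs a (suc b) = refl

distribution-step : ∀ (d c u v : List ℕ → ℕ) xs a b →
  sumL (λ π → d π * mono (suc (u π)) (v π) a b
            + c π * (v π * mono (suc (u π)) (v π) a b + suc (u π) * mono (u π) (suc (v π)) a b)) xs
    ≡ step (distribution d u v xs) (distribution c u v xs) a b
distribution-step d c u v xs a b = begin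
  sumL (λ π → d π * S π + c π * (v π * S π + suc (u π) * T π)) xs
    ≡⟨ sumL-cong xs (λ π → cong (λ t → d π * S π + c π * t)
         (cong₂ _+_ (mono-subst (λ _ y → y) (suc (u π)) (v π) a b) (mono-subst (λ x _ → suc x) (u π) (suc (v π)) a b))) ⟩
  sumL (λ π → d π * S π + c π * (b * S π + suc a * T π)) xs
    ≡⟨ sumL-cong xs (λ π → regroup (d π) (c π) (S π) (T π) b (suc a)) ⟩
  sumL (λ π → d π * S π + (b * (c π * S π) + suc a * (c π * T π))) xs
    ≡⟨ trans (sumL-+ _ _ xs) (cong (sumL (λ π → d π * S π) xs +_)
         (trans (sumL-+ _ _ xs) (cong₂ _+_ (sumL-scale b _ xs) (sumL-scale (suc a) _ xs)))) ⟩
  sumL (λ π → d π * S π) xs + (b * sumL (λ π → c π * S π) xs + suc a * sumL (λ π → c π * T π) xs)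
    ≡⟨ cong₂ (λ p q → p + q) (sumL-mono-s d u v xs a b)
         (cong₂ (λ p q → b * p + suc a * q) (sumL-mono-s c u v xs a b) (sumL-mono-t c u v xs a b)) ⟩
  step (distribution d u v xs) (distribution c u v xs) a b ∎
  where
  S T : List ℕ → ℕ
  S π = mono (suc (u π)) (v π) a b
  T π = mono (u π) (suc (v π)) a b
  regroup : ∀ d c s t b a → d * s + c * (b * s + a * t) ≡ d * s + (b * (c * s) + a * (c * t))
  regroup = solve-∀

signIs : Bool → List ℕ → ℕ
signIs par π = ind (does (even π Bool.≟ par))

AExcℕ : Bool → ℕ → Coeffs
AExcℕ par m = distribution (signIs par) sexp excW (permWords m)

signIs-flip : ∀ par π σ → even σ ≡ not (even π) → signIs par σ ≡ signIs (not par) π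
signIs-flip par π σ e rewrite e with even π | par
... | true  | true  = refl
... | true  | false = refl
... | false | true  = refl
... | false | false = refl

exc-transposeAt : ∀ m' π → IsPerm (suc m') π → ∀ par a b i → i < suc m' →
  signIs par (transpose (suc m') π i) * mono (sexp (transpose (suc m') π i)) (excW (transpose (suc m') π i)) a b
    ≡ signIs (not par) π * (mono (suc (sexp π)) (excW π) a b * ind (i <ᵇ getD 0 i π)
                            + mono (sexp π) (suc (excW π)) a b * ind (not (i <ᵇ getD 0 i π)))
exc-transposeAt m' π pπ par a b i i<m = cong₂ _*_ (signIs-flip par π σ even-σ) monomial
  where
  open TransposeAt (suc m') π pπ i i<m
  σ = transpose (suc m') π i
  S = mono (suc (sexp π)) (excW π) a b
  T = mono (sexp π) (suc (excW π)) a b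
  monomial : mono (sexp σ) (excW σ) a b
    ≡ mono (suc (sexp π)) (excW π) a b * ind (i <ᵇ getD 0 i π) + mono (sexp π) (suc (excW π)) a b * ind (not (i <ᵇ getD 0 i π))
  monomial with i <ᵇ getD 0 i π in i-exc
  ... | true  = trans (cong₂ (λ x y → mono x y a b) s-up t-same) (sym (select-first S T))
    where
    t-same : excW σ ≡ excW π
    t-same = ℕP.+-cancelʳ-≡ 1 _ _ (trans (cong (λ t → excW σ + ind t) (sym i-exc)) excW-σ)
    nexc-up : nexcW σ ≡ nexcW π + 1
    nexc-up = trans (sym (ℕP.+-identityʳ _)) (trans (cong (λ t → nexcW σ + ind (not t)) (sym i-exc)) nexcW-σ)
    s-up : sexp σ ≡ suc (sexp π)
    s-up = trans (cong (_∸ 1) nexc-up) (trans (ℕP.m+n∸n≡m (nexcW π) 1) (nexcW-pos m' π pπ))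
  ... | false = trans (cong₂ (λ x y → mono x y a b) s-same t-up) (sym (select-second S T))
    where
    t-up : excW σ ≡ suc (excW π)
    t-up = trans (sym (ℕP.+-identityʳ _))
      (trans (cong (λ t → excW σ + ind t) (sym i-exc)) (trans excW-σ (ℕP.+-comm (excW π) 1)))
    s-same : sexp σ ≡ sexp π
    s-same = cong (_∸ 1) (ℕP.+-cancelʳ-≡ 1 _ _ (trans (cong (λ t → nexcW σ + ind (not t)) (sym i-exc)) nexcW-σ))

exc-transpositions : ∀ m' π → IsPerm (suc m') π → ∀ par a b →
  sumBelow (suc (suc m')) (λ i → signIs par (transpose (suc m') π i)
                                 * mono (sexp (transpose (suc m') π i)) (excW (transpose (suc m') π i)) a b)
    ≡ signIs par π * mono (suc (sexp π)) (excW π) a b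
      + signIs (not par) π * (excW π * mono (suc (sexp π)) (excW π) a b + suc (sexp π) * mono (sexp π) (suc (excW π)) a b)
exc-transpositions m' π pπ par a b =
  trans (cong₂ _+_ inner last) (regroup (signIs (not par) π) (signIs par π) S T (excW π) (suc (sexp π)))
  where
  m = suc m'
  c = signIs (not par) π
  S = mono (suc (sexp π)) (excW π) a b
  T = mono (sexp π) (suc (excW π)) a b
  exc? nexc? : ℕ → ℕ
  exc?  i = ind (i <ᵇ getD 0 i π)
  nexc? i = ind (not (i <ᵇ getD 0 i π))
  -- over the positions, excedances and non-excedances are counted by excW and nexcW
  excs : sumBelow m exc? ≡ excW π
  excs = sym (trans (posCount-sumBelow _ π) (cong (λ k → sumBelow k exc?) (proj₁ pπ)))
  nexcs : sumBelow m nexc? ≡ suc (sexp π)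
  nexcs = trans (sym (trans (posCount-sumBelow _ π) (cong (λ k → sumBelow k nexc?) (proj₁ pπ)))) (nexcW-pos m' π pπ)
  inner : sumBelow m (λ i → signIs par (transpose m π i) * mono (sexp (transpose m π i)) (excW (transpose m π i)) a b)
          ≡ c * (S * excW π + T * suc (sexp π))
  inner = begin
    sumBelow m (λ i → signIs par (transpose m π i) * mono (sexp (transpose m π i)) (excW (transpose m π i)) a b)
      ≡⟨ sumBelow-cong m (λ i i<m → exc-transposeAt m' π pπ par a b i i<m) ⟩
    sumBelow m (λ i → c * (S * exc? i + T * nexc? i))
      ≡⟨ trans (sumBelow-scale m c _) (cong (c *_) (sumBelow-+ m _ _)) ⟩
    c * (sumBelow m (λ i → S * exc? i) + sumBelow m (λ i → T * nexc? i))
      ≡⟨ cong (c *_) (cong₂ _+_ (sumBelow-scale m S exc?) (sumBelow-scale m T nexc?)) ⟩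
    c * (S * sumBelow m exc? + T * sumBelow m nexc?)
      ≡⟨ cong (c *_) (cong₂ (λ p q → S * p + T * q) excs nexcs) ⟩
    c * (S * excW π + T * suc (sexp π)) ∎
  last : signIs par (transpose m π m) * mono (sexp (transpose m π m)) (excW (transpose m π m)) a b ≡ signIs par π * S
  last = cong₂ (λ e x → ind (does (e Bool.≟ par)) * x) even-σ (cong₂ (λ x y → mono x y a b) s-up excW-σ)
    where
    open TransposeLast m π pπ
    s-up : sexp (transpose m π m) ≡ suc (sexp π)
    s-up = trans (cong (_∸ 1) nexcW-σ) (trans (ℕP.m+n∸n≡m (nexcW π) 1) (nexcW-pos m' π pπ))
  regroup : ∀ c d s t e n → c * (s * e + t * n) + d * s ≡ d * s + c * (e * s + n * t)
  regroup = solve-∀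

AExcℕ-step : ∀ m' par a b → AExcℕ par (suc (suc m')) a b ≡ step (AExcℕ par (suc m')) (AExcℕ (not par) (suc m')) a b
AExcℕ-step m' par a b = begin
  AExcℕ par (suc m) a b
    ≡⟨ sum-decompose (transpositionDecomposition m) _ ⟩
  sumL (λ π → sumBelow (suc m) (λ i → signIs par (transpose m π i)
                                      * mono (sexp (transpose m π i)) (excW (transpose m π i)) a b)) (permWords m)
    ≡⟨ sumL-congᴬ (permWords-IsPerm m) (λ π pπ → exc-transpositions m' π pπ par a b) ⟩
  sumL (λ π → signIs par π * mono (suc (sexp π)) (excW π) a b
              + signIs (not par) π * (excW π * mono (suc (sexp π)) (excW π) a b
                                      + suc (sexp π) * mono (sexp π) (suc (excW π)) a b)) (permWords m)
    ≡⟨ distribution-step (signIs par) (signIs (not par)) sexp excW (permWords m) a b ⟩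
  step (AExcℕ par m) (AExcℕ (not par) m) a b ∎
  where m = suc m'

adjCount : (ℕ → ℕ → Bool) → List ℕ → ℕ
adjCount p []          = 0
adjCount p (x ∷ [])    = 0
adjCount p (x ∷ y ∷ l) = ind (p x y) + adjCount p (y ∷ l)

desW ascW : List ℕ → ℕ
desW = adjCount (λ x y → y <ᵇ x)
ascW = adjCount (λ x y → x <ᵇ y)

if≡ind : ∀ b → (if b then 1 else 0) ≡ ind b
if≡ind true  = refl
if≡ind false = refl

desL≡desW : ∀ l → desL l ≡ desW l
desL≡desW []          = refl
desL≡desW (x ∷ [])    = refl
desL≡desW (x ∷ y ∷ l) = cong₂ _+_ (if≡ind (y <ᵇ x)) (desL≡desW (y ∷ l))

ascL≡ascW : ∀ l → ascL l ≡ ascW l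
ascL≡ascW []          = refl
ascL≡ascW (x ∷ [])    = refl
ascL≡ascW (x ∷ y ∷ l) = cong₂ _+_ (if≡ind (x <ᵇ y)) (ascL≡ascW (y ∷ l))

adjCount-sumBelow : ∀ p l → adjCount p l ≡ sumBelow (length l ∸ 1) (λ k → ind (p (getD 0 k l) (getD 0 (suc k) l)))
adjCount-sumBelow p []          = refl
adjCount-sumBelow p (x ∷ [])    = refl
adjCount-sumBelow p (x ∷ y ∷ l) = trans (cong (ind (p x y) +_) (adjCount-sumBelow p (y ∷ l)))
  (sym (sumBelow-shift (length l) (λ k → ind (p (getD 0 k (x ∷ y ∷ l)) (getD 0 (suc k) (x ∷ y ∷ l))))))

adjCount-snoc : ∀ p w x r → adjCount p ((x ∷ r) ++ [ w ]) ≡ adjCount p (x ∷ r) + ind (p (lastL (x ∷ r)) w)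
adjCount-snoc p w x []      = ℕP.+-identityʳ (ind (p x w))
adjCount-snoc p w x (y ∷ r) =
  trans (cong (ind (p x y) +_) (adjCount-snoc p w y r)) (sym (ℕP.+-assoc (ind (p x y)) _ _))

adjCount-insAt : ∀ p w k l → suc k < length l →
  adjCount p (insAt (suc k) w l) + ind (p (getD 0 k l) (getD 0 (suc k) l))
    ≡ adjCount p l + (ind (p (getD 0 k l) w) + ind (p w (getD 0 (suc k) l)))
adjCount-insAt p w zero (x ∷ y ∷ r) _ = regroup (ind (p x w)) (ind (p w y)) (adjCount p (y ∷ r)) (ind (p x y))
  where regroup : ∀ a b c d → a + (b + c) + d ≡ d + c + (a + b)
        regroup = solve-∀
adjCount-insAt p w zero    (x ∷ []) (s≤s ())
adjCount-insAt p w (suc k) (x ∷ y ∷ r) (s≤s lt) = begin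
  ind (p x y) + adjCount p (insAt (suc k) w (y ∷ r)) + ind (p (getD 0 k (y ∷ r)) (getD 0 (suc k) (y ∷ r)))
    ≡⟨ ℕP.+-assoc (ind (p x y)) _ _ ⟩
  ind (p x y) + (adjCount p (insAt (suc k) w (y ∷ r)) + ind (p (getD 0 k (y ∷ r)) (getD 0 (suc k) (y ∷ r))))
    ≡⟨ cong (ind (p x y) +_) (adjCount-insAt p w k (y ∷ r) lt) ⟩
  ind (p x y) + (adjCount p (y ∷ r) + (ind (p (getD 0 k (y ∷ r)) w) + ind (p w (getD 0 (suc k) (y ∷ r)))))
    ≡⟨ sym (ℕP.+-assoc (ind (p x y)) _ _) ⟩
  ind (p x y) + adjCount p (y ∷ r) + (ind (p (getD 0 k (y ∷ r)) w) + ind (p w (getD 0 (suc k) (y ∷ r)))) ∎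

getD-bounded : ∀ m k l → allB (λ y → y <ᵇ m) l ≡ true → k < length l → getD 0 k l < m
getD-bounded m zero    (x ∷ l) h _       = <ᵇ-sound x m (proj₁ (∧-true {x <ᵇ m} h))
getD-bounded m (suc k) (x ∷ l) h (s≤s k<) = getD-bounded m k l (proj₂ (∧-true {x <ᵇ m} h)) k<

lastL-bounded : ∀ m x r → allB (λ y → y <ᵇ m) (x ∷ r) ≡ true → lastL (x ∷ r) < m
lastL-bounded m x []      h = <ᵇ-sound x m (proj₁ (∧-true {x <ᵇ m} h))
lastL-bounded m x (y ∷ r) h = lastL-bounded m y r (proj₂ (∧-true {x <ᵇ m} h))

adjacent-distinct : ∀ l → (∀ v → occ v l ≤ 1) → ∀ k → suc k < length l → (getD 0 k l ≡ᵇ getD 0 (suc k) l) ≡ false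
adjacent-distinct (x ∷ y ∷ r) h zero _ with x ≡ᵇ y in x≟y
... | false = refl
... | true  = ⊥-elim (ℕP.≤⇒≯ (subst (_≤ 1) twice (h x)) (s≤s (s≤s z≤n)))
  where
  twice : occ x (x ∷ y ∷ r) ≡ 2 + occ x r
  twice rewrite ≡ᵇ-refl x | x≟y = refl
adjacent-distinct (x ∷ [])    h zero (s≤s ())
adjacent-distinct (x ∷ y ∷ r) h (suc k) (s≤s lt) =
  adjacent-distinct (y ∷ r) (λ v → ℕP.≤-trans (ℕP.m≤n+m (occ v (y ∷ r)) (ind (v ≡ᵇ x))) (h v)) k lt

Eulℕ : ℕ → Coeffs
Eulℕ m = distribution (λ _ → 1) ascW desW (permWords m)

-- Inserting the new maximum strictly inside π, between its entries k and
-- k+1: a descent there becomes an ascent followed by a descent and vice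
-- versa, so exactly one of asc, des grows.
module _ (m' : ℕ) (π : List ℕ) (pπ : IsPerm (suc m') π) (k : ℕ) (k<m' : k < m') where
  private
    m = suc m'
    σ = insAt (suc k) m π
    S T : ℕ → ℕ → ℕ
    S a b = mono (suc (ascW π)) (desW π) a b
    T a b = mono (ascW π) (suc (desW π)) a b
    lt : suc k < length π
    lt = subst (suc k <_) (sym (proj₁ pπ)) (s≤s k<m')
    lk<m : getD 0 k π < m
    lk<m = getD-bounded m k π (IsPerm-bounded m π pπ) (ℕP.<⇒≤ lt)
    lk+1<m : getD 0 (suc k) π < m
    lk+1<m = getD-bounded m (suc k) π (IsPerm-bounded m π pπ) lt
    exactly-one : ind (getD 0 k π <ᵇ getD 0 (suc k) π) + ind (getD 0 (suc k) π <ᵇ getD 0 k π) ≡ 1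
    exactly-one = <ᵇ-trichotomy (getD 0 k π) (getD 0 (suc k) π)
      (adjacent-distinct π (λ v → subst (_≤ 1) (sym (proj₂ pπ v)) (ind≤1 _)) k lt)
    des-σ : desW σ + ind (getD 0 (suc k) π <ᵇ getD 0 k π) ≡ desW π + 1
    des-σ = trans (adjCount-insAt _ m k π lt)
      (cong₂ (λ s t → desW π + (ind s + ind t)) (<ᵇ-false (ℕP.<⇒≤ lk<m)) (<ᵇ-complete lk+1<m))
    asc-σ : ascW σ + ind (getD 0 k π <ᵇ getD 0 (suc k) π) ≡ ascW π + 1
    asc-σ = trans (adjCount-insAt _ m k π lt)
      (cong₂ (λ s t → ascW π + (ind s + ind t)) (<ᵇ-complete lk<m) (<ᵇ-false (ℕP.<⇒≤ lk+1<m)))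

  des-insertAt : ∀ a b →
    mono (ascW σ) (desW σ) a b
      ≡ mono (suc (ascW π)) (desW π) a b * ind (getD 0 (suc k) π <ᵇ getD 0 k π)
        + mono (ascW π) (suc (desW π)) a b * ind (getD 0 k π <ᵇ getD 0 (suc k) π)
  des-insertAt a b with getD 0 (suc k) π <ᵇ getD 0 k π in des-k | getD 0 k π <ᵇ getD 0 (suc k) π in asc-k
  ... | true  | true  = ⊥-elim (ℕP.1+n≢0 (ℕP.suc-injective (trans (sym (cong₂ (λ s t → ind s + ind t) asc-k des-k)) exactly-one)))
  ... | false | false = ⊥-elim (ℕP.0≢1+n (trans (sym (cong₂ (λ s t → ind s + ind t) asc-k des-k)) exactly-one))
  ... | true  | false = trans (cong₂ (λ x y → mono x y a b) asc-up des-same) (sym (select-first (S a b) (T a b)))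
    where
    des-same : desW σ ≡ desW π
    des-same = ℕP.+-cancelʳ-≡ 1 _ _ (trans (cong (λ t → desW σ + ind t) (sym des-k)) des-σ)
    asc-up : ascW σ ≡ suc (ascW π)
    asc-up = trans (sym (ℕP.+-identityʳ _)) (trans (cong (λ t → ascW σ + ind t) (sym asc-k)) (trans asc-σ (ℕP.+-comm (ascW π) 1)))
  ... | false | true  = trans (cong₂ (λ x y → mono x y a b) asc-same des-up) (sym (select-second (S a b) (T a b)))
    where
    des-up : desW σ ≡ suc (desW π)
    des-up = trans (sym (ℕP.+-identityʳ _)) (trans (cong (λ t → desW σ + ind t) (sym des-k)) (trans des-σ (ℕP.+-comm (desW π) 1)))
    asc-same : ascW σ ≡ ascW π
    asc-same = ℕP.+-cancelʳ-≡ 1 _ _ (trans (cong (λ t → ascW σ + ind t) (sym asc-k)) asc-σ)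

-- Summing over all m+1 insertion positions of the new maximum: in front it
-- adds a descent, at the end an ascent, and inside it acts as above.
des-insertions : ∀ m' π → IsPerm (suc m') π → ∀ a b →
  sumBelow (suc (suc m')) (λ j → 1 * mono (ascW (insAt j (suc m') π)) (desW (insAt j (suc m') π)) a b)
    ≡ 1 * mono (suc (ascW π)) (desW π) a b
      + 1 * (desW π * mono (suc (ascW π)) (desW π) a b + suc (ascW π) * mono (ascW π) (suc (desW π)) a b)
des-insertions m' []      (() , _) a b
des-insertions m' (x ∷ r) pπ       a b = begin
  sumBelow (suc m) f                      ≡⟨ sumBelow-shift m f ⟩
  f 0 + (sumBelow m' (λ k → f (suc k)) + f m) ≡⟨ cong₂ (λ p q → p + (q + f m)) front inside ⟩
  1 * T + (S * desW π + T * ascW π + f m) ≡⟨ cong (λ q → 1 * T + (S * desW π + T * ascW π + q)) back ⟩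
  1 * T + (S * desW π + T * ascW π + 1 * S) ≡⟨ regroup S T (desW π) (ascW π) ⟩
  1 * S + 1 * (desW π * S + suc (ascW π) * T) ∎
  where
  m = suc m'
  π = x ∷ r
  f : ℕ → ℕ
  f j = 1 * mono (ascW (insAt j m π)) (desW (insAt j m π)) a b
  S = mono (suc (ascW π)) (desW π) a b
  T = mono (ascW π) (suc (desW π)) a b
  π<m = IsPerm-bounded m π pπ
  length-r : length r ≡ m'
  length-r = ℕP.suc-injective (proj₁ pπ)
  x<m : x < m
  x<m = getD-bounded m 0 π π<m (s≤s z≤n)
  front : f 0 ≡ 1 * T
  front = cong (λ t → 1 * t) (cong₂ (λ p q → mono p q a b)
    (cong (_+ ascW π) (cong ind (<ᵇ-false (ℕP.<⇒≤ x<m))))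
    (cong (_+ desW π) (cong ind (<ᵇ-complete x<m))))
  inside : sumBelow m' (λ k → f (suc k)) ≡ S * desW π + T * ascW π
  inside = begin
    sumBelow m' (λ k → f (suc k))
      ≡⟨ sumBelow-cong m' (λ k k< → trans (ℕP.+-identityʳ _) (des-insertAt m' π pπ k k< a b)) ⟩
    sumBelow m' (λ k → S * ind (getD 0 (suc k) π <ᵇ getD 0 k π) + T * ind (getD 0 k π <ᵇ getD 0 (suc k) π))
      ≡⟨ trans (sumBelow-+ m' _ _) (cong₂ _+_ (sumBelow-scale m' S _) (sumBelow-scale m' T _)) ⟩
    S * sumBelow m' (λ k → ind (getD 0 (suc k) π <ᵇ getD 0 k π)) + T * sumBelow m' (λ k → ind (getD 0 k π <ᵇ getD 0 (suc k) π))
      ≡⟨ cong₂ (λ p q → S * p + T * q)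
           (sym (trans (adjCount-sumBelow _ π) (cong (λ n → sumBelow n (λ k → ind (getD 0 (suc k) π <ᵇ getD 0 k π))) length-r)))
           (sym (trans (adjCount-sumBelow _ π) (cong (λ n → sumBelow n (λ k → ind (getD 0 k π <ᵇ getD 0 (suc k) π))) length-r))) ⟩
    S * desW π + T * ascW π ∎
  back : f m ≡ 1 * S
  back = cong (λ t → 1 * t) (trans
    (cong (λ l → mono (ascW l) (desW l) a b) (trans (cong (λ j → insAt j m π) (sym (proj₁ pπ))) (insAt-end m π)))
    (cong₂ (λ p q → mono p q a b)
      (trans (adjCount-snoc _ m x r) (trans (cong (λ t → ascW π + ind t) (<ᵇ-complete last<m)) (ℕP.+-comm (ascW π) 1)))
      (trans (adjCount-snoc _ m x r) (trans (cong (λ t → desW π + ind t) (<ᵇ-false (ℕP.<⇒≤ last<m))) (ℕP.+-identityʳ _)))))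
    where
    last<m : lastL π < m
    last<m = lastL-bounded m x r π<m
  regroup : ∀ s t d e → 1 * t + (s * d + t * e + 1 * s) ≡ 1 * s + 1 * (d * s + suc e * t)
  regroup = solve-∀

Eulℕ-step : ∀ m' a b → Eulℕ (suc (suc m')) a b ≡ step (Eulℕ (suc m')) (Eulℕ (suc m')) a b
Eulℕ-step m' a b = begin
  Eulℕ (suc m) a b
    ≡⟨ sum-decompose (insertionDecomposition m) _ ⟩
  sumL (λ π → sumBelow (suc m) (λ j → 1 * mono (ascW (insAt j m π)) (desW (insAt j m π)) a b)) (permWords m)
    ≡⟨ sumL-congᴬ (permWords-IsPerm m) (λ π pπ → des-insertions m' π pπ a b) ⟩
  sumL (λ π → 1 * mono (suc (ascW π)) (desW π) a b
              + 1 * (desW π * mono (suc (ascW π)) (desW π) a b + suc (ascW π) * mono (ascW π) (suc (desW π)) a b)) (permWords m)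
    ≡⟨ distribution-step (λ _ → 1) (λ _ → 1) ascW desW (permWords m) a b ⟩
  step (Eulℕ m) (Eulℕ m) a b ∎
  where m = suc m'

Dℕ : Coeffs → Coeffs
Dℕ F a b = suc a * F (suc a) b + suc b * F a (suc b)

sMulℕ-cong : ∀ {F G : Coeffs} → (∀ a b → F a b ≡ G a b) → ∀ a b → sMulℕ F a b ≡ sMulℕ G a b
sMulℕ-cong h zero    b = refl
sMulℕ-cong h (suc a) b = h a b

tMulℕ-cong : ∀ {F G : Coeffs} → (∀ a b → F a b ≡ G a b) → ∀ a b → tMulℕ F a b ≡ tMulℕ G a b
tMulℕ-cong h a zero    = refl
tMulℕ-cong h a (suc b) = h a b

-- An explicit formula for D R(P, M), in which P enters only through P + M and DP.
D-step : ∀ P M a b → Dℕ (step P M) a b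
  ≡ P a b + M a b + sMulℕ (Dℕ P) a b + tMulℕ (Dℕ M) a b + (suc a * tMulℕ (Dℕ M) a b + suc b * sMulℕ (Dℕ M) a b)
D-step P M zero    zero    = expand (P 0 0) (M 0 0)
  where expand : ∀ p q → 1 * (p + (0 * q + 2 * 0)) + 1 * (0 + (1 * 0 + 1 * q)) ≡ p + q + 0 + 0 + (1 * 0 + 1 * 0)
        expand = solve-∀
D-step P M zero    (suc b) = expand b (P 0 (suc b)) (M 0 (suc b)) (M 1 b)
  where expand : ∀ b p q r → 1 * (p + (suc b * q + 2 * r)) + suc (suc b) * (0 + (suc (suc b) * 0 + 1 * q))
                               ≡ p + q + 0 + (1 * r + suc b * q) + (1 * (1 * r + suc b * q) + suc (suc b) * 0)
        expand = solve-∀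
D-step P M (suc a) zero    = expand a (P (suc a) 0) (P a 1) (M (suc a) 0) (M a 1)
  where expand : ∀ a p p' q q' → suc (suc a) * (p + (0 * q + suc (suc (suc a)) * 0)) + 1 * (p' + (1 * q' + suc (suc a) * q))
                                   ≡ p + q + (suc a * p + 1 * p') + 0 + (suc (suc a) * 0 + 1 * (suc a * q + 1 * q'))
        expand = solve-∀
D-step P M (suc a) (suc b) =
  expand a b (P (suc a) (suc b)) (P a (suc (suc b))) (M (suc a) (suc b)) (M (suc (suc a)) b) (M a (suc (suc b)))
  where expand : ∀ a b p p' q q' q'' →
                   suc (suc a) * (p + (suc b * q + suc (suc (suc a)) * q')) + suc (suc b) * (p' + (suc (suc b) * q'' + suc (suc a) * q))
                   ≡ p + q + (suc a * p + suc (suc b) * p') + (suc (suc a) * q' + suc b * q)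
                     + (suc (suc a) * (suc (suc a) * q' + suc b * q) + suc (suc b) * (suc a * q + suc (suc b) * q''))
        expand = solve-∀

D-step-swap : ∀ P M → (∀ a b → Dℕ P a b ≡ Dℕ M a b) → ∀ a b → Dℕ (step P M) a b ≡ Dℕ (step M P) a b
D-step-swap P M DP≡DM a b = begin
  Dℕ (step P M) a b
    ≡⟨ D-step P M a b ⟩
  P a b + M a b + sMulℕ (Dℕ P) a b + tMulℕ (Dℕ M) a b + (suc a * tMulℕ (Dℕ M) a b + suc b * sMulℕ (Dℕ M) a b)
    ≡⟨ cong₂ (λ p t → p + t + (suc a * t + suc b * sMulℕ (Dℕ M) a b))
         (cong₂ _+_ (ℕP.+-comm (P a b) (M a b)) (sMulℕ-cong DP≡DM a b)) (sym (tMulℕ-cong DP≡DM a b)) ⟩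
  M a b + P a b + sMulℕ (Dℕ M) a b + tMulℕ (Dℕ P) a b + (suc a * tMulℕ (Dℕ P) a b + suc b * sMulℕ (Dℕ M) a b)
    ≡⟨ cong (λ t → M a b + P a b + sMulℕ (Dℕ M) a b + tMulℕ (Dℕ P) a b + (suc a * tMulℕ (Dℕ P) a b + suc b * t))
            (sym (sMulℕ-cong DP≡DM a b)) ⟩
  M a b + P a b + sMulℕ (Dℕ M) a b + tMulℕ (Dℕ P) a b + (suc a * tMulℕ (Dℕ P) a b + suc b * sMulℕ (Dℕ P) a b)
    ≡⟨ sym (D-step M P a b) ⟩
  Dℕ (step M P) a b ∎

step-additive : ∀ P M E → (∀ a b → E a b ≡ P a b + M a b) → ∀ a b → step E E a b ≡ step P M a b + step M P a b
step-additive P M E E≡ a b = begin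
  step E E a b
    ≡⟨ cong₂ (λ s t → s + (b * s + suc a * t)) (trans (sMulℕ-cong E≡ a b) (split-s a)) (trans (tMulℕ-cong E≡ a b) (split-t b)) ⟩
  (sMulℕ P a b + sMulℕ M a b) + (b * (sMulℕ P a b + sMulℕ M a b) + suc a * (tMulℕ P a b + tMulℕ M a b))
    ≡⟨ regroup (sMulℕ P a b) (sMulℕ M a b) (tMulℕ P a b) (tMulℕ M a b) b (suc a) ⟩
  step P M a b + step M P a b ∎
  where
  split-s : ∀ a → sMulℕ (λ x y → P x y + M x y) a b ≡ sMulℕ P a b + sMulℕ M a b
  split-s zero    = refl
  split-s (suc a) = refl
  split-t : ∀ b → tMulℕ (λ x y → P x y + M x y) a b ≡ tMulℕ P a b + tMulℕ M a b
  split-t zero    = refl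
  split-t (suc b) = refl
  regroup : ∀ sp sm tp tm b a → sp + sm + (b * (sp + sm) + a * (tp + tm)) ≡ sp + (b * sm + a * tm) + (sm + (b * sp + a * tp))
  regroup = solve-∀

Invariant : ℕ → Set
Invariant m = (∀ a b → Eulℕ m a b ≡ AExcℕ true m a b + AExcℕ false m a b)
            × (∀ a b → Dℕ (AExcℕ true m) a b ≡ Dℕ (AExcℕ false m) a b)

-- For m = 1 every distribution is concentrated on s⁰t⁰ (and AExc⁻₁ = 0).
invariant-1 : Invariant 1
invariant-1 = split , derivative
  where
  split : ∀ a b → Eulℕ 1 a b ≡ AExcℕ true 1 a b + AExcℕ false 1 a b
  split zero    zero    = refl
  split zero    (suc b) = refl
  split (suc a) b       = refl
  no-s : ∀ a b → AExcℕ true 1 (suc a) b ≡ 0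
  no-s a b = refl
  no-t : ∀ a b → AExcℕ true 1 a (suc b) ≡ 0
  no-t zero    b = refl
  no-t (suc a) b = refl
  derivative : ∀ a b → Dℕ (AExcℕ true 1) a b ≡ Dℕ (AExcℕ false 1) a b
  derivative a b rewrite no-s a b | no-t a (suc b) = refl

invariant-step : ∀ m' → Invariant (suc m') → Invariant (suc (suc m'))
invariant-step m' (split , derivative) = split' , derivative'
  where
  m = suc m'
  split' : ∀ a b → Eulℕ (suc m) a b ≡ AExcℕ true (suc m) a b + AExcℕ false (suc m) a b
  split' a b = begin
    Eulℕ (suc m) a b                                                  ≡⟨ Eulℕ-step m' a b ⟩
    step (Eulℕ m) (Eulℕ m) a b
      ≡⟨ step-additive (AExcℕ true m) (AExcℕ false m) (Eulℕ m) split a b ⟩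
    step (AExcℕ true m) (AExcℕ false m) a b + step (AExcℕ false m) (AExcℕ true m) a b
      ≡⟨ sym (cong₂ _+_ (AExcℕ-step m' true a b) (AExcℕ-step m' false a b)) ⟩
    AExcℕ true (suc m) a b + AExcℕ false (suc m) a b                  ∎
  D-cong : ∀ {F G : Coeffs} → (∀ a b → F a b ≡ G a b) → ∀ a b → Dℕ F a b ≡ Dℕ G a b
  D-cong h a b = cong₂ _+_ (cong (suc a *_) (h (suc a) b)) (cong (suc b *_) (h a (suc b)))
  derivative' : ∀ a b → Dℕ (AExcℕ true (suc m)) a b ≡ Dℕ (AExcℕ false (suc m)) a b
  derivative' a b = begin
    Dℕ (AExcℕ true (suc m)) a b                           ≡⟨ D-cong (AExcℕ-step m' true) a b ⟩
    Dℕ (step (AExcℕ true m) (AExcℕ false m)) a b          ≡⟨ D-step-swap (AExcℕ true m) (AExcℕ false m) derivative a b ⟩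
    Dℕ (step (AExcℕ false m) (AExcℕ true m)) a b          ≡⟨ sym (D-cong (AExcℕ-step m' false) a b) ⟩
    Dℕ (AExcℕ false (suc m)) a b                          ∎

invariant : ∀ m' → Invariant (suc m')
invariant zero     = invariant-1
invariant (suc m') = invariant-step m' (invariant m')

AExc-count : ∀ par m a b →
  countB (λ π → ((nexc π ∸ 1) ≡ᵇ a) ∧ (exc π ≡ᵇ b)) (filter (λ π → evenPerm π Bool.≟ par) (perms m)) ≡ AExcℕ par m a b
AExc-count par m a b = begin
  countB (λ π → ((nexc π ∸ 1) ≡ᵇ a) ∧ (exc π ≡ᵇ b)) (filter (λ π → evenPerm π Bool.≟ par) (perms m))
    ≡⟨ countB≡sumL _ (filter (λ π → evenPerm π Bool.≟ par) (perms m)) ⟩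
  sumL (λ π → mono (nexc π ∸ 1) (exc π) a b) (filter (λ π → evenPerm π Bool.≟ par) (perms m))
    ≡⟨ sumL-filter (λ π → evenPerm π Bool.≟ par) _ (perms m) ⟩
  sumL (λ π → signIs par (vals π) * mono (nexc π ∸ 1) (exc π) a b) (perms m)
    ≡⟨ sumL-cong (perms m) (λ π → cong₂ (λ x y → signIs par (vals π) * mono (x ∸ 1) y a b) (nexc≡nexcW π) (exc≡excW π)) ⟩
  sumL (λ π → signIs par (vals π) * mono (sexp (vals π)) (excW (vals π)) a b) (perms m)
    ≡⟨ sym (sumL-map _ vals (perms m)) ⟩
  AExcℕ par m a b ∎

Eul-count : ∀ m a b → countB (λ π → (asc π ≡ᵇ a) ∧ (des π ≡ᵇ b)) (perms m) ≡ Eulℕ m a b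
Eul-count m a b = begin
  countB (λ π → (asc π ≡ᵇ a) ∧ (des π ≡ᵇ b)) (perms m)
    ≡⟨ countB≡sumL _ (perms m) ⟩
  sumL (λ π → mono (asc π) (des π) a b) (perms m)
    ≡⟨ sumL-cong (perms m) (λ π → trans (cong₂ (λ x y → mono x y a b) (ascL≡ascW (vals π)) (desL≡desW (vals π)))
                                         (sym (ℕP.*-identityˡ _))) ⟩
  sumL (λ π → 1 * mono (ascW (vals π)) (desW (vals π)) a b) (perms m)
    ≡⟨ sym (sumL-map _ vals (perms m)) ⟩
  Eulℕ m a b ∎

fromℕ≡mkℚ : ∀ k → fromℕ k ≡ mkℚ (ℤ.+ k) 0 (Coprime.sym (1-coprimeTo k))
fromℕ≡mkℚ k = QP.↥p/↧p≡p (mkℚ (ℤ.+ k) 0 (Coprime.sym (1-coprimeTo k)))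

fromℕ-+ : ∀ x y → fromℕ (x + y) ≡ fromℕ x Q.+ fromℕ y
fromℕ-+ x y = begin
  fromℕ (x + y)
    ≡⟨ cong (λ z → z Q./ 1) (cong₂ ℤ._+_ (sym (ℤP.*-identityʳ (ℤ.+ x))) (sym (ℤP.*-identityʳ (ℤ.+ y)))) ⟩
  mkℚ (ℤ.+ x) 0 (Coprime.sym (1-coprimeTo x)) Q.+ mkℚ (ℤ.+ y) 0 (Coprime.sym (1-coprimeTo y))
    ≡⟨ sym (cong₂ Q._+_ (fromℕ≡mkℚ x) (fromℕ≡mkℚ y)) ⟩
  fromℕ x Q.+ fromℕ y ∎

fromℕ-* : ∀ x y → fromℕ (x * y) ≡ fromℕ x Q.* fromℕ y
fromℕ-* x y = begin
  fromℕ (x * y)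
    ≡⟨ cong (λ z → z Q./ 1) (ℤP.pos-* x y) ⟩
  mkℚ (ℤ.+ x) 0 (Coprime.sym (1-coprimeTo x)) Q.* mkℚ (ℤ.+ y) 0 (Coprime.sym (1-coprimeTo y))
    ≡⟨ sym (cong₂ Q._*_ (fromℕ≡mkℚ x) (fromℕ≡mkℚ y)) ⟩
  fromℕ x Q.* fromℕ y ∎

½-double : ∀ x → ½ Q.* fromℕ (x + x) ≡ fromℕ x
½-double x = begin
  ½ Q.* fromℕ (x + x)           ≡⟨ cong (λ z → ½ Q.* fromℕ (x + z)) (sym (ℕP.+-identityʳ x)) ⟩
  ½ Q.* fromℕ (2 * x)           ≡⟨ cong (½ Q.*_) (fromℕ-* 2 x) ⟩
  ½ Q.* (fromℕ 2 Q.* fromℕ x)   ≡⟨ sym (QP.*-assoc ½ (fromℕ 2) (fromℕ x)) ⟩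
  (½ Q.* fromℕ 2) Q.* fromℕ x   ≡⟨ QP.*-identityˡ (fromℕ x) ⟩
  fromℕ x                       ∎

toℚ : Coeffs → Poly
toℚ F a b = fromℕ (F a b)

fromℕ-D : ∀ F a b → fromℕ (Dℕ F a b) ≡ D (toℚ F) a b
fromℕ-D F a b = trans (fromℕ-+ (suc a * F (suc a) b) (suc b * F a (suc b)))
  (cong₂ Q._+_ (fromℕ-* (suc a) (F (suc a) b)) (fromℕ-* (suc b) (F a (suc b))))

step-closed-form : ∀ P M E → (∀ a b → E a b ≡ P a b + M a b) → (∀ a b → Dℕ P a b ≡ Dℕ M a b) →
  ∀ a b → fromℕ (step P M a b) ≡ (sMul (toℚ P) ⊕ tMul (toℚ M) ⊕ ½ · sMul (tMul (D (toℚ E)))) a b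
step-closed-form P M E E≡ DP≡DM zero zero = refl
step-closed-form P M E E≡ DP≡DM zero (suc b) = begin
  fromℕ (0 + (suc b * 0 + 1 * M 0 b))   ≡⟨ cong fromℕ (simplify b (M 0 b)) ⟩
  fromℕ (M 0 b)                         ≡⟨ sym (trans (QP.+-identityʳ _) (QP.+-identityˡ _)) ⟩
  0ℚ Q.+ fromℕ (M 0 b) Q.+ 0ℚ           ∎
  where simplify : ∀ b x → 0 + (suc b * 0 + 1 * x) ≡ x
        simplify = solve-∀
step-closed-form P M E E≡ DP≡DM (suc a) zero = begin
  fromℕ (P a 0 + (0 * M a 0 + suc (suc a) * 0))  ≡⟨ cong fromℕ (simplify a (P a 0) (M a 0)) ⟩
  fromℕ (P a 0)                                  ≡⟨ sym (trans (QP.+-identityʳ _) (QP.+-identityʳ _)) ⟩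
  fromℕ (P a 0) Q.+ 0ℚ Q.+ 0ℚ                    ∎
  where simplify : ∀ a p x → p + (0 * x + suc (suc a) * 0) ≡ p
        simplify = solve-∀
step-closed-form P M E E≡ DP≡DM (suc a) (suc b) = begin
  fromℕ (step P M (suc a) (suc b))
    ≡⟨ cong fromℕ (split a b (P a (suc b)) (M a (suc b)) (M (suc a) b)) ⟩
  fromℕ (P a (suc b) + M (suc a) b + X)
    ≡⟨ trans (fromℕ-+ (P a (suc b) + M (suc a) b) X) (cong₂ Q._+_ (fromℕ-+ (P a (suc b)) (M (suc a) b)) (sym (½-double X))) ⟩
  fromℕ (P a (suc b)) Q.+ fromℕ (M (suc a) b) Q.+ ½ Q.* fromℕ (X + X)
    ≡⟨ cong (λ z → fromℕ (P a (suc b)) Q.+ fromℕ (M (suc a) b) Q.+ ½ Q.* z) (trans (cong fromℕ twice-X) (fromℕ-D E a b)) ⟩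
  fromℕ (P a (suc b)) Q.+ fromℕ (M (suc a) b) Q.+ ½ Q.* D (toℚ E) a b ∎
  where
  X = suc b * M a (suc b) + suc a * M (suc a) b
  split : ∀ a b p q r → p + (suc b * q + suc (suc a) * r) ≡ p + r + (suc b * q + suc a * r)
  split = solve-∀
  -- twice the mixed term is DM + DM = DP + DM = D(P + M)
  twice-X : X + X ≡ Dℕ E a b
  twice-X = begin
    X + X                     ≡⟨ cong (_+ X) (ℕP.+-comm (suc b * M a (suc b)) _) ⟩
    Dℕ M a b + X              ≡⟨ cong₂ _+_ (sym (DP≡DM a b)) (ℕP.+-comm (suc b * M a (suc b)) _) ⟩
    Dℕ P a b + Dℕ M a b       ≡⟨ collect (suc a) (suc b) (P (suc a) b) (P a (suc b)) (M (suc a) b) (M a (suc b)) ⟩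
    suc a * (P (suc a) b + M (suc a) b) + suc b * (P a (suc b) + M a (suc b))
      ≡⟨ sym (cong₂ (λ u v → suc a * u + suc b * v) (E≡ (suc a) b) (E≡ a (suc b))) ⟩
    Dℕ E a b                  ∎
    where
    collect : ∀ x y p q r s → (x * p + y * q) + (x * r + y * s) ≡ x * (p + r) + y * (q + s)
    collect = solve-∀

rhs : Poly → Poly → Poly → Poly
rhs P M E = sMul P ⊕ tMul M ⊕ ½ · sMul (tMul (D E))

rhs-cong : ∀ {P P' M M' E E' : Poly} → (∀ a b → P a b ≡ P' a b) → (∀ a b → M a b ≡ M' a b) → (∀ a b → E a b ≡ E' a b) →
  ∀ a b → rhs P M E a b ≡ rhs P' M' E' a b
rhs-cong {E = E} {E' = E'} hP hM hE a b =
  cong₂ Q._+_ (cong₂ Q._+_ (sMul-cong hP a b) (tMul-cong hM a b)) (cong (½ Q.*_) (sMul-cong (tMul-cong D-cong) a b))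
  where
  sMul-cong : ∀ {F G : Poly} → (∀ a b → F a b ≡ G a b) → ∀ a b → sMul F a b ≡ sMul G a b
  sMul-cong h zero    b = refl
  sMul-cong h (suc a) b = h a b
  tMul-cong : ∀ {F G : Poly} → (∀ a b → F a b ≡ G a b) → ∀ a b → tMul F a b ≡ tMul G a b
  tMul-cong h a zero    = refl
  tMul-cong h a (suc b) = h a b
  D-cong : ∀ a b → D E a b ≡ D E' a b
  D-cong a b = cong₂ Q._+_ (cong (fromℕ (suc a) Q.*_) (hE (suc a) b)) (cong (fromℕ (suc b) Q.*_) (hE a (suc b)))

AExcℕ-recurrence : ∀ k par a b →
  toℚ (AExcℕ par (suc (suc k))) a b ≡ rhs (toℚ (AExcℕ par (suc k))) (toℚ (AExcℕ (not par) (suc k))) (toℚ (Eulℕ (suc k))) a b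
AExcℕ-recurrence k par a b = trans (cong fromℕ (AExcℕ-step k par a b)) (closed-form par)
  where
  m = suc k
  E≡ = proj₁ (invariant k)
  D≡ = proj₂ (invariant k)
  closed-form : ∀ par → fromℕ (step (AExcℕ par m) (AExcℕ (not par) m) a b)
                       ≡ rhs (toℚ (AExcℕ par m)) (toℚ (AExcℕ (not par) m)) (toℚ (Eulℕ m)) a b
  closed-form true  = step-closed-form (AExcℕ true m) (AExcℕ false m) (Eulℕ m) E≡ D≡ a b
  closed-form false = step-closed-form (AExcℕ false m) (AExcℕ true m) (Eulℕ m)
    (λ x y → trans (E≡ x y) (ℕP.+-comm (AExcℕ true m x y) _)) (λ x y → sym (D≡ x y)) a b

AExc⁺≡ : ∀ m a b → AExc⁺ m a b ≡ toℚ (AExcℕ true m) a b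
AExc⁺≡ m a b = cong fromℕ (AExc-count true m a b)

AExc⁻≡ : ∀ m a b → AExc⁻ m a b ≡ toℚ (AExcℕ false m) a b
AExc⁻≡ m a b = cong fromℕ (AExc-count false m a b)

Eul≡ : ∀ m a b → Eul m a b ≡ toℚ (Eulℕ m) a b
Eul≡ m a b = cong fromℕ (Eul-count m a b)

lemma12 : (n : ℕ) → 2 ≤ n → (a b : ℕ) →
    (AExc⁺ n a b ≡ (sMul (AExc⁺ (n ∸ 1)) ⊕ tMul (AExc⁻ (n ∸ 1)) ⊕ ½ · sMul (tMul (D (Eul (n ∸ 1))))) a b)
    × (AExc⁻ n a b ≡ (sMul (AExc⁻ (n ∸ 1)) ⊕ tMul (AExc⁺ (n ∸ 1)) ⊕ ½ · sMul (tMul (D (Eul (n ∸ 1))))) a b)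
lemma12 (suc zero)    (s≤s ()) a b
lemma12 (suc (suc k)) _        a b =
  trans (AExc⁺≡ (suc (suc k)) a b) (trans (AExcℕ-recurrence k true a b)
    (sym (rhs-cong (AExc⁺≡ (suc k)) (AExc⁻≡ (suc k)) (Eul≡ (suc k)) a b))) ,
  trans (AExc⁻≡ (suc (suc k)) a b) (trans (AExcℕ-recurrence k false a b)
    (sym (rhs-cong (AExc⁻≡ (suc k)) (AExc⁺≡ (suc k)) (Eul≡ (suc k)) a b)))
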